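{- Let $1<n\le m$ and let $v$ be a vertex of $Z_{n,m}$ with $h(v)<h_{n,m}$. Then $d(v,0)\le d^0_{n,m}\le d_{n,m}$.
   Context: Elements of $\mathbb{Z}_n$ are identified with their smallest nonnegative representatives in $\{0,\dots,n-1\}$. The dYoke graph $Z_{n,m}$ has as vertices all tuples $u=(u_0,\dots,u_{m+1})$ with $u_0,u_{m+1}\in\mathbb{Z}_n$, $u_1,\dots,u_m\in\{ -1,0,1\}$ and $\sum_{i=0}^{m+1}u_i\equiv0\pmod n$; adjacency: there is $0\le i\le m$ with $u_j=v_j$ for $j\notin\{i,i+1\}$ and either ($u_i=v_i+1$, $u_{i+1}=v_{i+1}-1$) or ($u_i=v_i-1$, $u_{i+1}=v_{i+1}+1$), arithmetic in coordinates $0,m+1$ in $\mathbb{Z}_n$. $0$ is the all-zero vertex, $d$ is graph distance. A pivot of $v$ is an integer $-1\le p\le m+1$ such that $n\mid\sum_{i=0}^{p}v_i$ (empty sum $=0$); $\operatorname{Piv}(v)$ is the set of pivots. $h(v)=\min\{|p-\frac m2|:p\in\operatorname{Piv}(v)\}$; $h_{n,m}=\frac n2$ if $2\mid(m-n)$ and $h_{n,m}=\frac{n+1}{2}$ otherwise. $u^0_{n,m}$ is the vertex with $u_i=1$ for $1\le i\le m$ and $u_0\equiv-\lfloor\frac{m-n}{2}\rfloor\pmod n$; $d^0_{n,m}=d(u^0_{n,m},0)$. For $n<m$ with $m-n$ odd, $u^1_{n,m}$ is the vertex with $u_{\lceil(m+1)/2\rceil}=0$, $u_i=1$ for the other $1\le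 i\le m$, $u_0\equiv-\lfloor\frac{m-n}{2}\rfloor\pmod n$; $d^1_{n,m}=d(u^1_{n,m},0)$. Finally $d_{n,m}=d^0_{n,m}$ if $2\mid(m-n)$ and $d_{n,m}=\max\{d^0_{n,m},d^1_{n,m}\}$ otherwise. -}

module Defs where

open import Data.Nat as ℕ using (ℕ; zero; suc; _⊓_; NonZero)
open import Data.Nat.Divisibility as ℕD using (_∣?_)
open import Data.Integer as ℤ using (ℤ; +_; -_; _-_; ∣_∣; _%ℕ_)
open import Data.Integer.Divisibility as ℤD using ()
open import Data.Fin as Fin using (Fin; toℕ; inject₁)
open import Data.List as List using (List; []; _∷_; foldr; filter; map; take; tabulate; upTo)
open import Data.List.Relation.Unary.All using (All)
open import Data.Product using (Σ; ∃; ∃-syntax; _×_; _,_)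
open import Data.Sum using (_⊎_)
open import Data.Bool using (if_then_else_)
open import Relation.Nullary using (¬_; does)
open import Relation.Binary.PropositionalEquality using (_≡_; _≢_)

-- The coordinates u_0 and u_{m+1} (elements of ℤ_n) are represented by
-- their smallest nonnegative representatives, as integers in [0, n).

Tuple : ℕ → Set
Tuple m = Fin (suc (suc m)) → ℤ

prefixSum : ∀ {m} → Tuple m → ℕ → ℤ
prefixSum u k = foldr ℤ._+_ (+ 0) (take k (tabulate u))

totalSum : ∀ {m} → Tuple m → ℤ
totalSum {m} u = prefixSum u (suc (suc m))

-- index j ∈ {0, m+1} (the ℤ_n-valued coordinates)
IsEnd : ∀ {m} → Fin (suc (suc m)) → Set
IsEnd {m} j = toℕ j ≡ 0 ⊎ toℕ j ≡ suc m

IsVertex : (n m : ℕ) → Tuple m → Set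
IsVertex n m u =
  (∀ j → IsEnd j → (+ 0 ℤ.≤ u j) × (u j ℤ.< + n)) ×
  (∀ j → ¬ IsEnd j → (u j ≡ - (+ 1)) ⊎ (u j ≡ + 0) ⊎ (u j ≡ + 1)) ×
  (+ n ℤD.∣ totalSum u)

CoordEq : (n : ℕ) → ∀ {m} → Fin (suc (suc m)) → ℤ → ℤ → Set
CoordEq n j a b = (IsEnd j → + n ℤD.∣ (a - b)) × (¬ IsEnd j → a ≡ b)

Adj : (n m : ℕ) → Tuple m → Tuple m → Set
Adj n m u v = Σ (Fin (suc m)) λ i →
  (∀ j → j ≢ inject₁ i → j ≢ Fin.suc i → u j ≡ v j) ×
  ( (CoordEq n (inject₁ i) (u (inject₁ i)) (v (inject₁ i) ℤ.+ + 1) ×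
     CoordEq n (Fin.suc i) (u (Fin.suc i)) (v (Fin.suc i) - + 1))
  ⊎ (CoordEq n (inject₁ i) (u (inject₁ i)) (v (inject₁ i) - + 1) ×
     CoordEq n (Fin.suc i) (u (Fin.suc i)) (v (Fin.suc i) ℤ.+ + 1)))

-- walks of length k in Z_{n,m} (every vertex after the start is a vertex
-- of Z_{n,m}; the start is a vertex in all uses below)
data Walk (n m : ℕ) : Tuple m → Tuple m → ℕ → Set where
  [] : ∀ {u} → Walk n m u u 0
  _∷_ : ∀ {u v w k} → (IsVertex n m v × Adj n m u v) → Walk n m v w k →
        Walk n m u w (suc k)

DistAtMost : (n m : ℕ) → Tuple m → Tuple m → ℕ → Set
DistAtMost n m u w k = ∃[ j ] (j ℕ.≤ k × Walk n m u w j)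

-- d(u,w) ≤ max { d(x,y) : (x,y) ∈ ps }   (in ℕ ∪ {∞})
DistLeMax : (n m : ℕ) → Tuple m → Tuple m → List (Tuple m × Tuple m) → Set
DistLeMax n m u w ps =
  ∀ k → All (λ { (x , y) → DistAtMost n m x y k }) ps → DistAtMost n m u w k

zeroV : ∀ {m} → Tuple m
zeroV _ = + 0

-- Pivots and h.  A pivot p ∈ {-1,…,m+1} is encoded as p' = p + 1 ∈ {0,…,m+2};
-- p is a pivot iff n ∣ Σ_{i ≤ p} v_i = prefixSum v p'.

IsPivot : (n m : ℕ) → Tuple m → ℕ → Set
IsPivot n m v p' = + n ℤD.∣ prefixSum v p'

pivots : (n m : ℕ) → Tuple m → List ℕ
pivots n m v = filter (λ p' → n ∣? ∣ prefixSum v p' ∣) (upTo (suc (suc (suc m))))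

twiceDist : ℕ → ℕ → ℕ
twiceDist m p' = ∣ (+ 2 ℤ.* (+ p' - + 1)) - + m ∣

minList : List ℕ → ℕ
minList [] = 0
minList (x ∷ xs) = foldr _⊓_ x xs

twiceH : (n m : ℕ) → Tuple m → ℕ
twiceH n m v = minList (map (twiceDist m) (pivots n m v))

twiceHnm : (n m : ℕ) → ℕ
twiceHnm n m = if does (2 ∣? ∣ + m - + n ∣) then n else suc n

firstCoord : (n m : ℕ) .{{_ : NonZero n}} → ℤ
firstCoord n m = + ((- ((+ m - + n) ℤ./ℕ 2)) %ℕ n)

-- u^0: u_i = 1 for 1 ≤ i ≤ m; u_{m+1} is forced by the sum condition
u0 : (n m : ℕ) .{{_ : NonZero n}} → Tuple m
u0 n m j with toℕ j ℕ.≟ 0 | toℕ j ℕ.≟ suc m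
... | Relation.Nullary.yes _ | _ = firstCoord n m
... | Relation.Nullary.no _ | Relation.Nullary.yes _ =
      + ((- (firstCoord n m ℤ.+ + m)) %ℕ n)
... | Relation.Nullary.no _ | Relation.Nullary.no _ = + 1

-- u^1: as u^0 but u_{⌈(m+1)/2⌉} = 0
u1 : (n m : ℕ) .{{_ : NonZero n}} → Tuple m
u1 n m j with toℕ j ℕ.≟ 0 | toℕ j ℕ.≟ suc m | toℕ j ℕ.≟ (suc (suc m)) ℕ./ 2
... | Relation.Nullary.yes _ | _ | _ = firstCoord n m
... | Relation.Nullary.no _ | Relation.Nullary.yes _ | _ =
      + ((- (firstCoord n m ℤ.+ + m - + 1)) %ℕ n)
... | Relation.Nullary.no _ | Relation.Nullary.no _ | Relation.Nullary.yes _ = + 0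
... | Relation.Nullary.no _ | Relation.Nullary.no _ | Relation.Nullary.no _ = + 1

-- d_{n,m} = max { d(x,0) : x ∈ dList n m }
dList : (n m : ℕ) .{{_ : NonZero n}} → List (Tuple m × Tuple m)
dList n m = if does (2 ∣? ∣ + m - + n ∣)
            then (u0 n m , zeroV) ∷ []
            else (u0 n m , zeroV) ∷ (u1 n m , zeroV) ∷ []

module Submission where

-- Encode a walk from u to 0 by the prefix sums P_t(u) =
-- u_0 + … + u_{t-1}.  Lower bound: the potential Φ_e(u) = Σ_{t=1}^{m+1}
-- |e + P_t(u)| drops by at most one along an edge (after changing the offset e
-- by a multiple of n) and is 0 at 0, so d(u, 0) ≥ min_{n ∣ e} Φ_e(u); for u^0
-- the prefix sums climb by one, so Φ_e(u^0) = |c| + |c + 1| + … + |c + m|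
-- with c = e + u^0_0.  Upper bound: a vertex v with a pivot p = q + 1 reaches
-- 0 in tri q + tri (m - q) steps, by carrying every unit above p past
-- position m and every unit up to p into position 0 (the pivot makes the
-- final u_0 vanish).  This cost is the same window sum at c = -q, and such
-- window sums grow with |2c + m|; the hypothesis h(v) < h_{n,m} gives a pivot
-- with |2q - m| ≤ n - r (r the parity of m - n), while u^0_0 ≡ -⌊(m-n)/2⌋
-- makes |2c + m| ≥ n - r for every offset.

open import Defs
open import Data.Nat using (ℕ; _<_; _≤_; NonZero)
open import Data.List using (_∷_; [])
open import Data.Product using (_×_; _,_)

open import Data.Nat as ℕ using (zero; suc; z≤n; s≤s)
import Data.Nat.Properties as ℕP
import Data.Nat.DivMod as ℕDM
import Data.Nat.Divisibility as ℕD
open import Data.Integer as ℤ using (ℤ; +_; -_; -[1+_]; _+_; _-_; _*_; ∣_∣; +≤+; -≤-; +<+)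
import Data.Integer.Properties as ℤP
import Data.Integer.DivMod as ℤDM
import Data.Integer.Divisibility.Signed as ℤS
open import Data.Integer.Tactic.RingSolver using (solve-∀)
open import Data.Nat.Tactic.RingSolver using () renaming (solve-∀ to solveℕ-∀)
open import Data.Fin using (Fin; toℕ; fromℕ<; inject₁) renaming (zero to fzero; suc to fsuc)
import Data.Fin.Properties as FinP
open import Data.List using (List; foldr; take; tabulate; map; upTo)
open import Data.List.Membership.Propositional using (_∈_)
open import Data.List.Membership.Propositional.Properties using (∈-map∘filter⁻; ∈-filter⁺; ∈-upTo⁺; ∈-upTo⁻; ∈-map⁺)
open import Data.List.Relation.Unary.Any using (here; there)
open import Data.List.Relation.Unary.All as All using (All; _∷_)
open import Data.Sum using (_⊎_; inj₁; inj₂; [_,_]′)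
open import Data.Product using (Σ; proj₁; proj₂)
open import Data.Bool using (if_then_else_)
open import Data.Empty using (⊥-elim)
open import Relation.Binary.PropositionalEquality
open import Relation.Binary.Definitions using (tri<; tri≈; tri>)
open import Relation.Nullary using (yes; no; ¬_; Dec; does)


prefix : ∀ {N} → (Fin N → ℤ) → ℕ → ℤ
prefix f k = foldr _+_ (+ 0) (take k (tabulate f))

prefix-snoc : ∀ {N} (f : Fin N → ℤ) k .(k<N : k < N) →
              prefix f (suc k) ≡ prefix f k + f (fromℕ< k<N)
prefix-snoc {suc N} f zero _ = trans (ℤP.+-identityʳ (f fzero)) (sym (ℤP.+-identityˡ _))
prefix-snoc {suc N} f (suc k) k<N =
  trans (cong (λ t → f fzero + t) (prefix-snoc (λ j → f (fsuc j)) k (ℕP.≤-pred k<N)))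
        (sym (ℤP.+-assoc (f fzero) _ _))

prefix-cong : ∀ {N} (f g : Fin N → ℤ) k → (∀ j → toℕ j < k → f j ≡ g j) →
              prefix f k ≡ prefix g k
prefix-cong {zero} f g zero _ = refl
prefix-cong {zero} f g (suc k) _ = refl
prefix-cong {suc N} f g zero _ = refl
prefix-cong {suc N} f g (suc k) h =
  cong₂ _+_ (h fzero (s≤s z≤n))
            (prefix-cong (λ j → f (fsuc j)) (λ j → g (fsuc j)) k (λ j p → h (fsuc j) (s≤s p)))

prefix-zero : ∀ {N} (f : Fin N → ℤ) → (∀ j → f j ≡ + 0) → ∀ k → prefix f k ≡ + 0
prefix-zero {zero} f _ zero = refl
prefix-zero {zero} f _ (suc k) = refl
prefix-zero {suc N} f _ zero = refl
prefix-zero {suc N} f h (suc k) = cong₂ _+_ (h fzero) (prefix-zero (λ j → f (fsuc j)) (λ j → h (fsuc j)) k)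

partial : (ℕ → ℤ) → ℕ → ℤ
partial d zero = + 0
partial d (suc k) = partial d k + d k

prefix-shift : ∀ {N} (f g : Fin N → ℤ) (d : ℕ → ℤ) → (∀ j → f j ≡ g j + d (toℕ j)) →
               ∀ k → k ≤ N → prefix f k ≡ prefix g k + partial d k
prefix-shift f g d h zero _ = sym (ℤP.+-identityʳ _)
prefix-shift {N} f g d h (suc k) k<N = begin
    prefix f (suc k)                              ≡⟨ prefix-snoc f k k<N ⟩
    prefix f k + f j                              ≡⟨ cong₂ _+_ (prefix-shift f g d h k (ℕP.<⇒≤ k<N)) (h j) ⟩
    (prefix g k + partial d k) + (g j + d (toℕ j)) ≡⟨ cong (λ t → (prefix g k + partial d k) + (g j + d t)) (FinP.toℕ-fromℕ< k<N) ⟩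
    (prefix g k + partial d k) + (g j + d k)      ≡⟨ interchange (prefix g k) (partial d k) (g j) (d k) ⟩
    (prefix g k + g j) + (partial d k + d k)      ≡⟨ cong (_+ _) (sym (prefix-snoc g k k<N)) ⟩
    prefix g (suc k) + partial d (suc k)          ∎
  where
  open ≡-Reasoning
  j : Fin N
  j = fromℕ< k<N
  interchange : ∀ (a b c e : ℤ) → (a + b) + (c + e) ≡ (a + c) + (b + e)
  interchange = solve-∀

-- The sequence that is x at i, y at i + 1 and 0 elsewhere: the difference of
-- two adjacent vertices of Z_{n,m}.
bump : ℕ → ℤ → ℤ → ℕ → ℤ
bump i x y t with t ℕ.≟ i | t ℕ.≟ suc i
... | yes _ | _ = x
... | no _ | yes _ = y
... | no _ | no _ = + 0

bump-at : ∀ i x y → bump i x y i ≡ x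
bump-at i x y with i ℕ.≟ i
... | yes _ = refl
... | no i≢i = ⊥-elim (i≢i refl)

bump-next : ∀ i x y → bump i x y (suc i) ≡ y
bump-next i x y with suc i ℕ.≟ i | suc i ℕ.≟ suc i
... | yes 1+i≡i | _ = ⊥-elim (ℕP.1+n≢n 1+i≡i)
... | no _ | yes _ = refl
... | no _ | no ≢ = ⊥-elim (≢ refl)

bump-off : ∀ i x y t → t ≢ i → t ≢ suc i → bump i x y t ≡ + 0
bump-off i x y t t≢i t≢1+i with t ℕ.≟ i | t ℕ.≟ suc i
... | yes t≡i | _ = ⊥-elim (t≢i t≡i)
... | no _ | yes t≡1+i = ⊥-elim (t≢1+i t≡1+i)
... | no _ | no _ = refl

partial-bump-below : ∀ i x y k → k ≤ i → partial (bump i x y) k ≡ + 0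
partial-bump-below i x y zero _ = refl
partial-bump-below i x y (suc k) k<i =
  cong₂ _+_ (partial-bump-below i x y k (ℕP.<⇒≤ k<i))
            (bump-off i x y k (ℕP.<⇒≢ k<i) (ℕP.<⇒≢ (ℕP.m≤n⇒m≤1+n k<i)))

partial-bump-at : ∀ i x y → partial (bump i x y) (suc i) ≡ x
partial-bump-at i x y =
  trans (cong₂ _+_ (partial-bump-below i x y i ℕP.≤-refl) (bump-at i x y)) (ℤP.+-identityˡ x)

partial-bump-above : ∀ i x y k → suc (suc i) ≤ k → partial (bump i x y) k ≡ x + y
partial-bump-above i x y (suc k) (s≤s 1+i≤k) with ℕP.m≤n⇒m<n∨m≡n 1+i≤k
... | inj₂ refl = cong₂ _+_ (partial-bump-at i x y) (bump-next i x y)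
... | inj₁ 1+i<k =
  trans (cong₂ _+_ (partial-bump-above i x y k 1+i<k)
                   (bump-off i x y k (λ k≡i → ℕP.<⇒≢ (ℕP.<-trans (ℕP.n<1+n i) 1+i<k) (sym k≡i))
                                     (λ k≡1+i → ℕP.<⇒≢ 1+i<k (sym k≡1+i))))
        (ℤP.+-identityʳ _)

-- Window sums absSum m c = |c| + |c + 1| + … + |c + m|; both the lower bound
-- for u^0 and the cost of the walk from v are such sums.
absSum : ℕ → ℤ → ℕ
absSum zero c = ∣ c ∣
absSum (suc m) c = absSum m c ℕ.+ ∣ c + + suc m ∣

absSum-head : ∀ m c → absSum (suc m) c ≡ ∣ c ∣ ℕ.+ absSum m (c + + 1)
absSum-head zero c = refl
absSum-head (suc m) c = begin
    absSum (suc m) c ℕ.+ ∣ c + + suc (suc m) ∣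
      ≡⟨ cong (ℕ._+ ∣ c + + suc (suc m) ∣) (absSum-head m c) ⟩
    (∣ c ∣ ℕ.+ absSum m (c + + 1)) ℕ.+ ∣ c + + suc (suc m) ∣
      ≡⟨ ℕP.+-assoc ∣ c ∣ _ _ ⟩
    ∣ c ∣ ℕ.+ (absSum m (c + + 1) ℕ.+ ∣ c + + suc (suc m) ∣)
      ≡⟨ cong (λ t → ∣ c ∣ ℕ.+ (absSum m (c + + 1) ℕ.+ ∣ t ∣)) (sym (ℤP.+-assoc c (+ 1) (+ suc m))) ⟩
    ∣ c ∣ ℕ.+ absSum (suc m) (c + + 1) ∎
  where open ≡-Reasoning

-- The reflection t ↦ -m - t maps {c, …, c + m} onto {-m-c, …, -c}.
absSum-reflect : ∀ m c → absSum m c ≡ absSum m (- (+ m) - c)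
absSum-reflect zero c = sym (trans (cong ∣_∣ (ℤP.+-identityˡ (- c))) (ℤP.∣-i∣≡∣i∣ c))
absSum-reflect (suc m) c = begin
    absSum (suc m) c                              ≡⟨ absSum-head m c ⟩
    ∣ c ∣ ℕ.+ absSum m (c + + 1)                  ≡⟨ cong (∣ c ∣ ℕ.+_) (absSum-reflect m (c + + 1)) ⟩
    ∣ c ∣ ℕ.+ absSum m (- (+ m) - (c + + 1))      ≡⟨ ℕP.+-comm ∣ c ∣ _ ⟩
    absSum m (- (+ m) - (c + + 1)) ℕ.+ ∣ c ∣
      ≡⟨ cong₂ (λ a b → absSum m a ℕ.+ b) (shift (+ m) c)
               (trans (sym (ℤP.∣-i∣≡∣i∣ c)) (cong ∣_∣ (last (+ m) c))) ⟩
    absSum (suc m) (- (+ suc m) - c)              ∎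
  where
  open ≡-Reasoning
  shift : ∀ (a c : ℤ) → - a - (c + + 1) ≡ - (+ 1 + a) - c
  shift = solve-∀
  last : ∀ (a c : ℤ) → - c ≡ - (+ 1 + a) - c + (+ 1 + a)
  last = solve-∀

absLe : ∀ x y → - y ℤ.≤ x → x ℤ.≤ y → ∣ x ∣ ≤ ∣ y ∣
absLe (+ a) (+ b) _ (+≤+ a≤b) = a≤b
absLe (+ a) -[1+ b ] _ ()
absLe -[1+ a ] (+ zero) () _
absLe -[1+ a ] (+ suc b) (-≤- b≤a) _ = s≤s b≤a
absLe -[1+ a ] -[1+ b ] () _

≤-from-diff : ∀ {a b} e → + 0 ℤ.≤ e → e ≡ b - a → a ℤ.≤ b
≤-from-diff e 0≤e e≡b-a = ℤP.0≤i-j⇒j≤i (subst (+ 0 ℤ.≤_) e≡b-a 0≤e)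

-- Shifting the window one step up removes |c| and adds |c + m + 1|, which is
-- no smaller once the window is centred at or above 0 (2c + m + 1 ≥ 0).
absSum-up1 : ∀ m c → + 0 ℤ.≤ c + c + + suc m → absSum m c ≤ absSum m (c + + 1)
absSum-up1 m c centred =
  ℕP.+-cancelʳ-≤ ∣ c ∣ _ _
    (subst (absSum m c ℕ.+ ∣ c ∣ ≤_) (sym step) (ℕP.+-monoʳ-≤ (absSum m c) |c|≤|c+m+1|))
  where
  step : absSum m (c + + 1) ℕ.+ ∣ c ∣ ≡ absSum m c ℕ.+ ∣ c + + suc m ∣
  step = trans (ℕP.+-comm _ ∣ c ∣) (sym (absSum-head m c))
  lower : ∀ (c d : ℤ) → c + c + d ≡ c - (- (c + d))
  lower = solve-∀
  upper : ∀ (c d : ℤ) → d ≡ (c + d) - c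
  upper = solve-∀
  |c|≤|c+m+1| : ∣ c ∣ ≤ ∣ c + + suc m ∣
  |c|≤|c+m+1| = absLe c (c + + suc m) (≤-from-diff _ centred (lower c (+ suc m)))
                       (≤-from-diff (+ suc m) (+≤+ z≤n) (upper c (+ suc m)))

absSum-up : ∀ m c d → + 0 ℤ.≤ c + c + + m → absSum m c ≤ absSum m (c + + d)
absSum-up m c zero _ = ℕP.≤-reflexive (cong (absSum m) (sym (ℤP.+-identityʳ c)))
absSum-up m c (suc d) centred =
  ℕP.≤-trans (absSum-up m c d centred)
    (subst (absSum m (c + + d) ≤_) (cong (absSum m) (assoc c (+ d)))
           (absSum-up1 m (c + + d) (ℤP.≤-trans centred (≤-from-diff _ (+≤+ z≤n) (sym (gap c (+ d) (+ m)))))))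
  where
  assoc : ∀ (c d : ℤ) → c + d + + 1 ≡ c + (+ 1 + d)
  assoc = solve-∀
  gap : ∀ (c d m : ℤ) → c + d + (c + d) + (+ 1 + m) - (c + c + m) ≡ d + d + + 1
  gap = solve-∀

centredCopy : ∀ m c → Σ ℤ λ c' → (absSum m c ≡ absSum m c') × (c' + c' + + m ≡ + ∣ c + c + + m ∣)
centredCopy m c with ℤP.≤-total (+ 0) (c + c + + m)
... | inj₁ 0≤ = c , refl , sym (ℤP.0≤i⇒+∣i∣≡i 0≤)
... | inj₂ ≤0 = - (+ m) - c , absSum-reflect m c ,
      trans (mirror c (+ m)) (trans (sym (ℤP.0≤i⇒+∣i∣≡i (ℤP.neg-mono-≤ ≤0)))
                                    (cong +_ (ℤP.∣-i∣≡∣i∣ (c + c + + m))))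
  where
  mirror : ∀ (c m : ℤ) → (- m - c) + (- m - c) + m ≡ - (c + c + m)
  mirror = solve-∀

absSum-mono : ∀ m c c' → ∣ c + c + + m ∣ ≤ ∣ c' + c' + + m ∣ → absSum m c ≤ absSum m c'
absSum-mono m c c' le with centredCopy m c | centredCopy m c'
... | a , ca , a-centre | b , cb , b-centre =
  subst₂ _≤_ (sym ca) (sym cb)
    (subst (λ t → absSum m a ≤ absSum m t) (sym b≡a+d) (absSum-up m a ∣ b - a ∣ 0≤a-centre))
  where
  0≤a-centre : + 0 ℤ.≤ a + a + + m
  0≤a-centre = subst (+ 0 ℤ.≤_) (sym a-centre) (+≤+ z≤n)
  twice : ∀ (a b m : ℤ) → (b + b + m) - (a + a + m) ≡ (b - a) + (b - a)
  twice = solve-∀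
  half : ∀ x → + 0 ℤ.≤ x + x → + 0 ℤ.≤ x
  half (+ k) _ = +≤+ z≤n
  half -[1+ k ] ()
  0≤b-a : + 0 ℤ.≤ b - a
  0≤b-a = half (b - a) (subst (+ 0 ℤ.≤_) (twice a b (+ m))
            (ℤP.i≤j⇒0≤j-i (subst₂ ℤ._≤_ (sym a-centre) (sym b-centre) (+≤+ le))))
  split : ∀ (a b : ℤ) → b ≡ a + (b - a)
  split = solve-∀
  b≡a+d : b ≡ a + + ∣ b - a ∣
  b≡a+d = trans (split a b) (cong (λ t → a + t) (sym (ℤP.0≤i⇒+∣i∣≡i 0≤b-a)))

tri : ℕ → ℕ
tri zero = 0
tri (suc k) = tri k ℕ.+ suc k

absSum-at-neg : ∀ q m → q ≤ m → absSum m (- (+ q)) ≡ tri q ℕ.+ tri (m ℕ.∸ q)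
absSum-at-neg zero m _ = absSum-from-0 m
  where
  absSum-from-0 : ∀ m → absSum m (+ 0) ≡ tri m
  absSum-from-0 zero = refl
  absSum-from-0 (suc m) = cong (ℕ._+ suc m) (absSum-from-0 m)
absSum-at-neg (suc q) (suc m) (s≤s q≤m) = begin
    absSum (suc m) (- (+ suc q))                ≡⟨ absSum-head m _ ⟩
    suc q ℕ.+ absSum m (- (+ suc q) + + 1)      ≡⟨ cong (λ t → suc q ℕ.+ absSum m t) (drop1 (+ q)) ⟩
    suc q ℕ.+ absSum m (- (+ q))                ≡⟨ cong (suc q ℕ.+_) (absSum-at-neg q m q≤m) ⟩
    suc q ℕ.+ (tri q ℕ.+ tri (m ℕ.∸ q))         ≡⟨ sym (ℕP.+-assoc (suc q) _ _) ⟩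
    (suc q ℕ.+ tri q) ℕ.+ tri (m ℕ.∸ q)         ≡⟨ cong (ℕ._+ tri (m ℕ.∸ q)) (ℕP.+-comm (suc q) _) ⟩
    tri (suc q) ℕ.+ tri (m ℕ.∸ q)               ∎
  where
  open ≡-Reasoning
  drop1 : ∀ (x : ℤ) → - (+ 1 + x) + + 1 ≡ - x
  drop1 = solve-∀

-- Three consecutive integers have absolute values summing to at least 2.
absSum-≥2 : ∀ m c → 2 ≤ m → 2 ≤ absSum m c
absSum-≥2 zero c ()
absSum-≥2 (suc zero) c (s≤s ())
absSum-≥2 (suc (suc zero)) c _ = three c
  where
  three : ∀ c → 2 ≤ absSum 2 c
  three (+ zero) = s≤s (s≤s z≤n)
  three (+ suc k) = ℕP.≤-trans (ℕP.m≤n+m 2 (suc k)) (ℕP.m≤n+m _ (suc k ℕ.+ ∣ + suc k + + 1 ∣))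
  three -[1+ zero ] = s≤s (s≤s z≤n)
  three -[1+ suc k ] = s≤s (s≤s z≤n)
absSum-≥2 (suc (suc (suc m))) c _ = ℕP.≤-trans (absSum-≥2 (suc (suc m)) c (s≤s (s≤s z≤n))) (ℕP.m≤m+n _ _)

Unit : ℤ → Set
Unit s = s ≡ + 1 ⊎ s ≡ -[1+ 0 ]

∣unit∣ : ∀ {s} → Unit s → ∣ s ∣ ≡ 1
∣unit∣ (inj₁ refl) = refl
∣unit∣ (inj₂ refl) = refl

sumBelow : (ℕ → ℕ) → ℕ → ℕ
sumBelow a zero = 0
sumBelow a (suc T) = sumBelow a T ℕ.+ a T

sumBelow-≤ : ∀ (a b : ℕ → ℕ) i T → (∀ t → t < T → t ≢ i → a t ≤ b t) → a i ≤ suc (b i) →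
             (T ≤ i → sumBelow a T ≤ sumBelow b T) × (sumBelow a T ≤ suc (sumBelow b T))
sumBelow-≤ a b i zero same near = (λ _ → z≤n) , z≤n
sumBelow-≤ a b i (suc T) same near
  with sumBelow-≤ a b i T (λ t t<T → same t (ℕP.m≤n⇒m≤1+n t<T)) near | ℕP.<-cmp T i
... | below , _ | tri< T<i _ _ =
      (λ _ → ℕP.+-mono-≤ (below (ℕP.<⇒≤ T<i)) lastTerm) ,
      ℕP.+-mono-≤ (ℕP.m≤n⇒m≤1+n (below (ℕP.<⇒≤ T<i))) lastTerm
  where
  lastTerm : a T ≤ b T
  lastTerm = same T ℕP.≤-refl (ℕP.<⇒≢ T<i)
... | below , _ | tri≈ _ refl _ =
      (λ 1+i≤i → ⊥-elim (ℕP.1+n≰n 1+i≤i)) ,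
      subst (sumBelow a T ℕ.+ a T ≤_) (ℕP.+-suc _ _) (ℕP.+-mono-≤ (below ℕP.≤-refl) near)
... | _ , bound | tri> _ _ i<T =
      (λ 1+T≤i → ⊥-elim (ℕP.<⇒≱ i<T (ℕP.<⇒≤ 1+T≤i))) ,
      ℕP.+-mono-≤ bound (same T ℕP.≤-refl (λ T≡i → ℕP.<⇒≢ i<T (sym T≡i)))

module _ (n m : ℕ) where

  isEnd? : (j : Fin (suc (suc m))) → Dec (IsEnd j)
  isEnd? j with toℕ j ℕ.≟ 0 | toℕ j ℕ.≟ suc m
  ... | yes j≡0 | _ = yes (inj₁ j≡0)
  ... | no _ | yes j≡1+m = yes (inj₂ j≡1+m)
  ... | no j≢0 | no j≢1+m = no λ { (inj₁ j≡0) → j≢0 j≡0 ; (inj₂ j≡1+m) → j≢1+m j≡1+m }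

  coordEq-lift : ∀ j a b → CoordEq n j a b →
                 Σ ℤ λ t → (a ≡ b + t * + n) × (¬ IsEnd j → t ≡ + 0)
  coordEq-lift j a b (atEnd , inside) with isEnd? j
  ... | no inner = + 0 , trans (inside inner) (sym (ℤP.+-identityʳ b)) , (λ _ → refl)
  ... | yes end with ℤS.∣ᵤ⇒∣ (atEnd end)
  ... | ℤS.divides t a-b≡tn = t , trans (split a b) (cong (λ z → b + z) a-b≡tn) , (λ inner → ⊥-elim (inner end))
    where
    split : ∀ a b → a ≡ b + (a - b)
    split = solve-∀

  differ-by-bump : (u v : Tuple m) (i : Fin (suc m)) (x y : ℤ) →
    (∀ j → j ≢ inject₁ i → j ≢ fsuc i → u j ≡ v j) →
    u (inject₁ i) ≡ v (inject₁ i) + x → u (fsuc i) ≡ v (fsuc i) + y →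
    ∀ j → u j ≡ v j + bump (toℕ i) x y (toℕ j)
  differ-by-bump u v i x y rest atI atNext j with toℕ j ℕ.≟ toℕ i | toℕ j ℕ.≟ suc (toℕ i)
  ... | yes j≡i | _ rewrite FinP.toℕ-injective {i = j} {j = inject₁ i} (trans j≡i (sym (FinP.toℕ-inject₁ i))) = atI
  ... | no _ | yes j≡1+i rewrite FinP.toℕ-injective {i = j} {j = fsuc i} j≡1+i = atNext
  ... | no j≢i | no j≢1+i =
      trans (rest j (λ j≡ → j≢i (trans (cong toℕ j≡) (FinP.toℕ-inject₁ i))) (λ j≡ → j≢1+i (cong toℕ j≡)))
            (sym (ℤP.+-identityʳ (v j)))

  -- An edge u — v of Z_{n,m}, read arithmetically: one unit s crosses from
  -- position i to i + 1, up to multiples of n at the end coordinates.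
  record Edge (u v : Tuple m) : Set where
    field
      i : ℕ
      i≤m : i ≤ m
      s : ℤ
      unit : Unit s
      t₁ t₂ : ℤ
      t₁-end : i ≡ 0 ⊎ t₁ ≡ + 0
      t₂-end : i ≡ m ⊎ t₂ ≡ + 0
      diff : ∀ j → u j ≡ v j + bump i (- s + t₁ * + n) (s + t₂ * + n) (toℕ j)

  edgeFrom : ∀ {u v} (i : Fin (suc m)) (s : ℤ) → Unit s →
    (∀ j → j ≢ inject₁ i → j ≢ fsuc i → u j ≡ v j) →
    CoordEq n (inject₁ i) (u (inject₁ i)) (v (inject₁ i) - s) →
    CoordEq n (fsuc i) (u (fsuc i)) (v (fsuc i) + s) → Edge u v
  edgeFrom {u} {v} i s unit rest atI atNext with coordEq-lift _ _ _ atI | coordEq-lift _ _ _ atNext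
  ... | t₁ , u≡₁ , inner₁ | t₂ , u≡₂ , inner₂ = record
    { i = toℕ i ; i≤m = ℕP.≤-pred (FinP.toℕ<n i) ; s = s ; unit = unit ; t₁ = t₁ ; t₂ = t₂
    ; t₁-end = t₁-end ; t₂-end = t₂-end
    ; diff = differ-by-bump u v i _ _ rest (trans u≡₁ (reassoc (v (inject₁ i)) s (t₁ * + n)))
                                            (trans u≡₂ (ℤP.+-assoc (v (fsuc i)) s (t₂ * + n))) }
    where
    reassoc : ∀ a b c → a - b + c ≡ a + (- b + c)
    reassoc = solve-∀
    t₁-end : toℕ i ≡ 0 ⊎ t₁ ≡ + 0
    t₁-end with toℕ i ℕ.≟ 0
    ... | yes i≡0 = inj₁ i≡0
    ... | no i≢0 = inj₂ (inner₁ λ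
      { (inj₁ i≡0) → i≢0 (trans (sym (FinP.toℕ-inject₁ i)) i≡0)
      ; (inj₂ i≡1+m) → ℕP.<⇒≢ (FinP.toℕ<n i) (trans (sym (FinP.toℕ-inject₁ i)) i≡1+m) })
    t₂-end : toℕ i ≡ m ⊎ t₂ ≡ + 0
    t₂-end with toℕ i ℕ.≟ m
    ... | yes i≡m = inj₁ i≡m
    ... | no i≢m = inj₂ (inner₂ λ { (inj₁ ()) ; (inj₂ 1+i≡1+m) → i≢m (ℕP.suc-injective 1+i≡1+m) })

  edge : ∀ {u v} → Adj n m u v → Edge u v
  edge (i , rest , inj₁ (atI , atNext)) = edgeFrom i -[1+ 0 ] (inj₂ refl) rest atI atNext
  edge (i , rest , inj₂ (atI , atNext)) = edgeFrom i (+ 1) (inj₁ refl) rest atI atNext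

  edge-total : ∀ {u v} → Edge u v → + n ℤS.∣ totalSum u → + n ℤS.∣ totalSum v
  edge-total {u} {v} E n∣u = ℤS.∣m+n∣n⇒∣m (subst (+ n ℤS.∣_) u≡v+tn n∣u) (ℤS.∣n⇒∣m*n (t₁ + t₂) ℤS.∣-refl)
    where
    open Edge E
    x y : ℤ
    x = - s + t₁ * + n
    y = s + t₂ * + n
    u≡v+tn : totalSum u ≡ totalSum v + (t₁ + t₂) * + n
    u≡v+tn = trans (prefix-shift u v (bump i x y) diff (suc (suc m)) ℕP.≤-refl)
                   (trans (cong (λ t → totalSum v + t) (partial-bump-above i x y (suc (suc m)) (s≤s (s≤s i≤m))))
                          (cancel (totalSum v) s t₁ t₂ (+ n)))
      where
      cancel : ∀ a s t₁ t₂ n → a + ((- s + t₁ * n) + (s + t₂ * n)) ≡ a + (t₁ + t₂) * n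
      cancel = solve-∀

  -- It vanishes at 0 (with e = 0) and an edge
  -- changes it by at most one once e is re-chosen modulo n.
  potential : Tuple m → ℤ → ℕ
  potential u e = sumBelow (λ t → ∣ e + prefix u (suc t) ∣) (suc m)

  module _ {u v : Tuple m} (E : Edge u v) (e : ℤ) where
    open Edge E

    private
      x y e' : ℤ
      x = - s + t₁ * + n
      y = s + t₂ * + n
      e' = e - t₁ * + n

      prefix≡ : ∀ t → t ≤ m → prefix u (suc t) ≡ prefix v (suc t) + partial (bump i x y) (suc t)
      prefix≡ t t≤m = prefix-shift u v (bump i x y) diff (suc t) (s≤s (ℕP.m≤n⇒m≤1+n t≤m))

    -- Before position i the prefix sums agree (and t₁ = 0 as i ≠ 0).
    term-below : ∀ t → t < i → ∣ e' + prefix u (suc t) ∣ ≡ ∣ e + prefix v (suc t) ∣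
    term-below t t<i = cong ∣_∣ (begin
        e - t₁ * + n + prefix u (suc t)
          ≡⟨ cong₂ (λ a b → e - a * + n + b) t₁≡0 (prefix≡ t (ℕP.≤-trans (ℕP.<⇒≤ t<i) i≤m)) ⟩
        e - + 0 * + n + (prefix v (suc t) + partial (bump i x y) (suc t))
          ≡⟨ cong (λ z → e - + 0 * + n + (prefix v (suc t) + z)) (partial-bump-below i x y (suc t) t<i) ⟩
        e - + 0 * + n + (prefix v (suc t) + + 0)
          ≡⟨ simplify e (prefix v (suc t)) (+ n) ⟩
        e + prefix v (suc t) ∎)
      where
      open ≡-Reasoning
      t₁≡0 : t₁ ≡ + 0
      t₁≡0 with t₁-end
      ... | inj₁ refl = ⊥-elim (ℕP.n≮0 t<i)
      ... | inj₂ t₁≡0 = t₁≡0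
      simplify : ∀ a b c → a - + 0 * c + (b + + 0) ≡ a + b
      simplify = solve-∀

    term-at : ∣ e' + prefix u (suc i) ∣ ≤ suc ∣ e + prefix v (suc i) ∣
    term-at = subst (λ z → ∣ z ∣ ≤ suc ∣ w ∣) (sym shifted)
                (ℕP.≤-trans (ℤP.∣i-j∣≤∣i∣+∣j∣ w s)
                            (ℕP.≤-reflexive (trans (cong (∣ w ∣ ℕ.+_) (∣unit∣ unit)) (ℕP.+-comm ∣ w ∣ 1))))
      where
      w : ℤ
      w = e + prefix v (suc i)
      cancel : ∀ e t n p s → e - t * n + (p + (- s + t * n)) ≡ e + p - s
      cancel = solve-∀
      shifted : e' + prefix u (suc i) ≡ w - s
      shifted = trans (cong (λ z → e' + z) (trans (prefix≡ i i≤m) (cong (λ z → prefix v (suc i) + z) (partial-bump-at i x y))))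
                      (cancel e t₁ (+ n) (prefix v (suc i)) s)

    -- After position i the unit has arrived (and t₂ = 0 as i ≠ m).
    term-above : ∀ t → i < t → t ≤ m → ∣ e' + prefix u (suc t) ∣ ≡ ∣ e + prefix v (suc t) ∣
    term-above t i<t t≤m = cong ∣_∣ (begin
        e' + prefix u (suc t)
          ≡⟨ cong (λ z → e' + z) (prefix≡ t t≤m) ⟩
        e' + (prefix v (suc t) + partial (bump i x y) (suc t))
          ≡⟨ cong (λ z → e' + (prefix v (suc t) + z)) (partial-bump-above i x y (suc t) (s≤s i<t)) ⟩
        e' + (prefix v (suc t) + (x + (s + t₂ * + n)))
          ≡⟨ cong (λ z → e' + (prefix v (suc t) + (x + (s + z * + n)))) t₂≡0 ⟩
        e' + (prefix v (suc t) + (x + (s + + 0 * + n)))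
          ≡⟨ cancel e t₁ (+ n) (prefix v (suc t)) s ⟩
        e + prefix v (suc t) ∎)
      where
      open ≡-Reasoning
      t₂≡0 : t₂ ≡ + 0
      t₂≡0 with t₂-end
      ... | inj₁ refl = ⊥-elim (ℕP.<⇒≱ i<t t≤m)
      ... | inj₂ t₂≡0 = t₂≡0
      cancel : ∀ e t n p s → e - t * n + (p + ((- s + t * n) + (s + + 0 * n))) ≡ e + p
      cancel = solve-∀

    potential-edge : potential u e' ≤ suc (potential v e)
    potential-edge = proj₂ (sumBelow-≤ _ _ i (suc m) termwise term-at)
      where
      termwise : ∀ t → t < suc m → t ≢ i → ∣ e' + prefix u (suc t) ∣ ≤ ∣ e + prefix v (suc t) ∣
      termwise t (s≤s t≤m) t≢i with ℕP.<-cmp t i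
      ... | tri< t<i _ _ = ℕP.≤-reflexive (term-below t t<i)
      ... | tri≈ _ t≡i _ = ⊥-elim (t≢i t≡i)
      ... | tri> _ _ i<t = ℕP.≤-reflexive (term-above t i<t t≤m)

  potential-walk : ∀ {u k} → Walk n m u zeroV k →
                   Σ ℤ λ e → (+ n ℤS.∣ e) × potential u e ≤ k
  potential-walk [] = + 0 , ℤS.divides (+ 0) refl , ℕP.≤-reflexive (at-zero (suc m))
    where
    at-zero : ∀ T → sumBelow (λ t → ∣ + 0 + prefix (zeroV {m}) (suc t) ∣) T ≡ 0
    at-zero zero = refl
    at-zero (suc T) = cong₂ ℕ._+_ (at-zero T) (cong ∣_∣ (trans (ℤP.+-identityˡ _) (prefix-zero zeroV (λ _ → refl) (suc T))))
  potential-walk {u} (_∷_ {v = v} (_ , adj) w) with potential-walk w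
  ... | e , n∣e , Φ≤k = e - t₁ * + n , ℤS.∣m∣n⇒∣m-n n∣e (ℤS.∣n⇒∣m*n t₁ ℤS.∣-refl) ,
                         ℕP.≤-trans (potential-edge E e) (s≤s Φ≤k)
    where
    E : Edge u v
    E = edge adj
    open Edge E using (t₁)

sumBelow-absSum : ∀ k c (a : ℕ → ℕ) → (∀ t → t ≤ k → a t ≡ ∣ c + + t ∣) → sumBelow a (suc k) ≡ absSum k c
sumBelow-absSum zero c a at = trans (at 0 z≤n) (cong ∣_∣ (ℤP.+-identityʳ c))
sumBelow-absSum (suc k) c a at =
  cong₂ ℕ._+_ (sumBelow-absSum k c a (λ t t≤k → at t (ℕP.m≤n⇒m≤1+n t≤k))) (at (suc k) ℕP.≤-refl)

module _ (n m : ℕ) .{{_ : NonZero n}} where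

  u0-inner : ∀ j → toℕ j ≢ 0 → toℕ j ≢ suc m → u0 n m j ≡ + 1
  u0-inner j j≢0 j≢1+m with toℕ j ℕ.≟ 0 | toℕ j ℕ.≟ suc m
  ... | yes j≡0 | _ = ⊥-elim (j≢0 j≡0)
  ... | no _ | yes j≡1+m = ⊥-elim (j≢1+m j≡1+m)
  ... | no _ | no _ = refl

  prefix-u0 : ∀ t → t ≤ m → prefix (u0 n m) (suc t) ≡ firstCoord n m + + t
  prefix-u0 zero _ = refl
  prefix-u0 (suc t) t<m = begin
      prefix (u0 n m) (suc (suc t))          ≡⟨ prefix-snoc (u0 n m) (suc t) 1+t<2+m ⟩
      prefix (u0 n m) (suc t) + u0 n m j     ≡⟨ cong₂ _+_ (prefix-u0 t (ℕP.<⇒≤ t<m)) (u0-inner j j≢0 j≢1+m) ⟩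
      firstCoord n m + + t + + 1             ≡⟨ ℤP.+-assoc (firstCoord n m) (+ t) (+ 1) ⟩
      firstCoord n m + + (t ℕ.+ 1)           ≡⟨ cong (λ z → firstCoord n m + + z) (ℕP.+-comm t 1) ⟩
      firstCoord n m + + suc t               ∎
    where
    open ≡-Reasoning
    1+t<2+m : suc t < suc (suc m)
    1+t<2+m = s≤s (ℕP.m≤n⇒m≤1+n t<m)
    j : Fin (suc (suc m))
    j = fromℕ< 1+t<2+m
    j≢0 : toℕ j ≢ 0
    j≢0 j≡0 = ℕP.1+n≢0 (trans (sym (FinP.toℕ-fromℕ< 1+t<2+m)) j≡0)
    j≢1+m : toℕ j ≢ suc m
    j≢1+m j≡1+m = ℕP.<⇒≢ (s≤s t<m) (trans (sym (FinP.toℕ-fromℕ< 1+t<2+m)) j≡1+m)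

  potential-u0 : ∀ e → potential n m (u0 n m) e ≡ absSum m (e + firstCoord n m)
  potential-u0 e = sumBelow-absSum m (e + firstCoord n m) _
    (λ t t≤m → cong ∣_∣ (trans (cong (λ z → e + z) (prefix-u0 t t≤m)) (sym (ℤP.+-assoc e (firstCoord n m) (+ t)))))

  potential-u0≥2 : 2 ≤ m → ∀ e → 2 ≤ potential n m (u0 n m) e
  potential-u0≥2 2≤m e = subst (2 ≤_) (sym (potential-u0 e)) (absSum-≥2 m (e + firstCoord n m) 2≤m)

∣oddMultiple+r∣ : ∀ T (n r : ℕ) → 1 ≤ n → r ≤ 1 → n ℕ.∸ r ≤ ∣ T * (+ n + + n) + (+ n + + r) ∣
∣oddMultiple+r∣ (+ k) n r _ _ =
  ℕP.≤-trans (ℕP.m∸n≤m n r) (ℕP.≤-trans (ℕP.m≤m+n n r)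
    (subst (n ℕ.+ r ≤_) (cong (λ z → ∣ z + (+ n + + r) ∣) (ℤP.pos-* k (n ℕ.+ n))) (ℕP.m≤n+m (n ℕ.+ r) (k ℕ.* (n ℕ.+ n)))))
∣oddMultiple+r∣ -[1+ k ] n r 1≤n r≤1 = subst (n ℕ.∸ r ≤_) (sym abs≡) (ℕP.∸-monoˡ-≤ r (ℕP.m≤m+n n _))
  where
  M : ℕ
  M = n ℕ.+ k ℕ.* (n ℕ.+ n)
  negate : ∀ K N R → - (+ 1 + K) * (N + N) + (N + R) ≡ R - (N + K * (N + N))
  negate = solve-∀
  abs≡ : ∣ -[1+ k ] * (+ n + + n) + (+ n + + r) ∣ ≡ M ℕ.∸ r
  abs≡ = trans (cong ∣_∣ (trans (negate (+ k) (+ n) (+ r))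
                               (trans (cong (λ z → + r - (+ n + z)) (sym (ℤP.pos-* k (n ℕ.+ n)))) (ℤP.m-n≡m⊖n r M))))
               (ℤP.∣⊖∣-≤ (ℕP.≤-trans r≤1 (ℕP.≤-trans 1≤n (ℕP.m≤m+n n _))))

2∣∣2*z∣ : ∀ z → 2 ℕD.∣ ∣ + 2 * z ∣
2∣∣2*z∣ z = ℕD.divides ∣ z ∣ (trans (ℤP.abs-* (+ 2) z) (ℕP.*-comm 2 ∣ z ∣))

-- The pivot encoded by p' (p = p' - 1) has |2p - m| = |2(1 - p') + m|, and
-- if that equals n then m - n is even (m ∓ |2p - m| ∈ {2p, 2m - 2p}).
twiceDist-centre : ∀ m p' → ∣ (+ 1 - + p') + (+ 1 - + p') + + m ∣ ≡ twiceDist m p'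
twiceDist-centre m p' = trans (cong ∣_∣ (negated (+ p') (+ m))) (ℤP.∣-i∣≡∣i∣ (+ 2 * (+ p' - + 1) - + m))
  where
  negated : ∀ p m → (+ 1 - p) + (+ 1 - p) + m ≡ - (+ 2 * (p - + 1) - m)
  negated = solve-∀

twiceDist≡n⇒even : ∀ n m p' → twiceDist m p' ≡ n → 2 ℕD.∣ ∣ + m - + n ∣
twiceDist≡n⇒even n m p' td≡n with ℤP.+∣i∣≡i⊎+∣i∣≡-i (+ 2 * (+ p' - + 1) - + m)
... | inj₁ |x|≡x = subst (λ z → 2 ℕD.∣ ∣ z ∣) (sym (trans (cong (λ z → + m - z) n≡x) (case₁ (+ p') (+ m))))
                         (2∣∣2*z∣ (+ m - (+ p' - + 1)))
  where
  n≡x : + n ≡ + 2 * (+ p' - + 1) - + m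
  n≡x = trans (cong +_ (sym td≡n)) |x|≡x
  case₁ : ∀ p m → m - (+ 2 * (p - + 1) - m) ≡ + 2 * (m - (p - + 1))
  case₁ = solve-∀
... | inj₂ |x|≡-x = subst (λ z → 2 ℕD.∣ ∣ z ∣) (sym (trans (cong (λ z → + m - z) n≡-x) (case₂ (+ p') (+ m))))
                          (2∣∣2*z∣ (+ p' - + 1))
  where
  n≡-x : + n ≡ - (+ 2 * (+ p' - + 1) - + m)
  n≡-x = trans (cong +_ (sym td≡n)) |x|≡-x
  case₂ : ∀ p m → m - (- (+ 2 * (p - + 1) - m)) ≡ + 2 * (p - + 1)
  case₂ = solve-∀

-- Writing m - n = r + 2q (r ≤ 1), we have u^0_0 ≡ -q (mod n), so every
-- window of u^0 is centred at least n - r away from 0, while the window of a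
-- pivot p with 2|p - m/2| < 2h_{n,m} is centred at most n - r away.
module _ (n m : ℕ) .{{_ : NonZero n}} (n≤m : n ≤ m) where

  private
    D r q : ℕ
    D = m ℕ.∸ n
    r = D ℕ.% 2
    q = D ℕ./ 2
    K : ℤ
    K = (- (+ q)) ℤ./ℕ n

    r≤1 : r ≤ 1
    r≤1 = ℕP.≤-pred (ℕDM.m%n<n D 2)

    m-n≡D : + m - + n ≡ + D
    m-n≡D = trans (ℤP.m-n≡m⊖n m n) (ℤP.⊖-≥ n≤m)

    m≡n+r+2q : + m ≡ + n + + r + + q + + q
    m≡n+r+2q = cong +_ (begin
        m                          ≡⟨ sym (ℕP.m+[n∸m]≡n n≤m) ⟩
        n ℕ.+ D                    ≡⟨ cong (n ℕ.+_) (ℕDM.m≡m%n+[m/n]*n D 2) ⟩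
        n ℕ.+ (r ℕ.+ q ℕ.* 2)      ≡⟨ regroup n r q ⟩
        n ℕ.+ r ℕ.+ q ℕ.+ q        ∎)
      where
      open ≡-Reasoning
      regroup : ∀ a b c → a ℕ.+ (b ℕ.+ c ℕ.* 2) ≡ a ℕ.+ b ℕ.+ c ℕ.+ c
      regroup = solveℕ-∀

    firstCoord≡ : firstCoord n m ≡ - (+ q) - K * + n
    firstCoord≡ = trans (cong (λ z → + ((- (z ℤ./ℕ 2)) ℤ.%ℕ n)) m-n≡D)
                        (move (ℤDM.a≡a%ℕn+[a/ℕn]*n (- (+ q)) n))
      where
      move : ∀ {a b c} → a ≡ b + c → b ≡ a - c
      move {a} {b} {c} a≡b+c = trans (cancel b c) (cong (_- c) (sym a≡b+c))
        where
        cancel : ∀ b c → b ≡ b + c - c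
        cancel = solve-∀

  u0-centre : ∀ e → + n ℤS.∣ e →
              n ℕ.∸ r ≤ ∣ (e + firstCoord n m) + (e + firstCoord n m) + + m ∣
  u0-centre e (ℤS.divides Q e≡Qn) =
    subst (λ z → n ℕ.∸ r ≤ ∣ z ∣) (sym centre≡) (∣oddMultiple+r∣ (Q - K) n r (ℕ.>-nonZero⁻¹ n) r≤1)
    where
    expand : ∀ Q K q N R → (Q * N + (- q - K * N)) + (Q * N + (- q - K * N)) + (N + R + q + q)
                           ≡ (Q - K) * (N + N) + (N + R)
    expand = solve-∀
    centre≡ : (e + firstCoord n m) + (e + firstCoord n m) + + m ≡ (Q - K) * (+ n + + n) + (+ n + + r)
    centre≡ = trans (cong₂ (λ a b → (a + b) + (a + b) + + m) e≡Qn firstCoord≡)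
                    (trans (cong (λ z → (Q * + n + (- (+ q) - K * + n)) + (Q * + n + (- (+ q) - K * + n)) + z) m≡n+r+2q)
                           (expand Q K (+ q) (+ n) (+ r)))

  -- Pivots below the threshold: 2|p - m/2| < 2h_{n,m} gives |2p - m| ≤ n - r
  -- (for odd m - n, |2p - m| ≡ m ≢ n (mod 2) excludes |2p - m| = n).
  pivot-centre : ∀ p' → twiceDist m p' < twiceHnm n m → twiceDist m p' ≤ n ℕ.∸ r
  pivot-centre p' = by-parity (2 ℕD.∣? ∣ + m - + n ∣)
    where
    by-parity : (d : Dec (2 ℕD.∣ ∣ + m - + n ∣)) →
                twiceDist m p' < (if does d then n else suc n) → twiceDist m p' ≤ n ℕ.∸ r
    by-parity (yes even) td<n = subst (λ z → twiceDist m p' ≤ n ℕ.∸ z) (sym r≡0) (ℕP.<⇒≤ td<n)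
      where
      r≡0 : r ≡ 0
      r≡0 = ℕD.n∣m⇒m%n≡0 D 2 (subst (2 ℕD.∣_) (cong ∣_∣ m-n≡D) even)
    by-parity (no odd) td≤n = subst (λ z → twiceDist m p' ≤ n ℕ.∸ z) (sym r≡1)
                                (ℕP.<⇒≤pred (ℕP.≤∧≢⇒< (ℕP.≤-pred td≤n) (λ td≡n → odd (twiceDist≡n⇒even n m p' td≡n))))
      where
      r≢0 : r ≢ 0
      r≢0 r≡0 = odd (subst (2 ℕD.∣_) (sym (cong ∣_∣ m-n≡D)) (ℕD.m%n≡0⇒n∣m D 2 r≡0))
      r≡1 : r ≡ 1
      r≡1 = one r r≤1 r≢0
        where
        one : ∀ x → x ≤ 1 → x ≢ 0 → x ≡ 1
        one zero _ x≢0 = ⊥-elim (x≢0 refl)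
        one (suc zero) _ _ = refl
        one (suc (suc x)) (s≤s ()) _

  -- The key comparison: the cost tri q + tri (m - q) = absSum m (-q) of
  -- clearing around a pivot q + 1 below the threshold is at most every
  -- Φ_e(u^0) with n ∣ e, as the window at -q is the more central one.
  pivot-cost≤potential-u0 : ∀ q → q ≤ m → twiceDist m (suc q) < twiceHnm n m → ∀ e → + n ℤS.∣ e →
                            tri q ℕ.+ tri (m ℕ.∸ q) ≤ potential n m (u0 n m) e
  pivot-cost≤potential-u0 q q≤m below e n∣e = begin
      tri q ℕ.+ tri (m ℕ.∸ q)          ≡⟨ sym (absSum-at-neg q m q≤m) ⟩
      absSum m (- (+ q))               ≡⟨ cong (absSum m) (shift (+ q)) ⟩
      absSum m (+ 1 - + suc q)         ≤⟨ absSum-mono m _ _ more-central ⟩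
      absSum m (e + firstCoord n m)    ≡⟨ sym (potential-u0 n m e) ⟩
      potential n m (u0 n m) e         ∎
    where
    open ℕP.≤-Reasoning
    shift : ∀ q → - q ≡ + 1 - (+ 1 + q)
    shift = solve-∀
    more-central : ∣ (+ 1 - + suc q) + (+ 1 - + suc q) + + m ∣ ≤ ∣ (e + firstCoord n m) + (e + firstCoord n m) + + m ∣
    more-central = ℕP.≤-trans (ℕP.≤-reflexive (twiceDist-centre m (suc q)))
                              (ℕP.≤-trans (pivot-centre (suc q) below) (u0-centre e n∣e))

_++ʷ_ : ∀ {n m x y z k l} → Walk n m x y k → Walk n m y z l → Walk n m x z (k ℕ.+ l)
[] ++ʷ w = w
(step ∷ w₁) ++ʷ w = step ∷ (w₁ ++ʷ w)

walk-vertex : ∀ {n m x y k} → IsVertex n m x → Walk n m x y k → IsVertex n m y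
walk-vertex vx [] = vx
walk-vertex _ ((vy , _) ∷ w) = walk-vertex vy w

module _ (n m : ℕ) .{{_ : NonZero n}} where

  -- Pointwise equality of tuples (walks can only be retargeted along it).
  _≐_ : Tuple m → Tuple m → Set
  x ≐ y = ∀ j → x j ≡ y j

  Digit : ℤ → Set
  Digit a = (a ≡ - (+ 1)) ⊎ (a ≡ + 0) ⊎ (a ≡ + 1)

  Admissible : Fin (suc (suc m)) → ℤ → Set
  Admissible j a = (IsEnd j → (+ 0 ℤ.≤ a) × (a ℤ.< + n)) × (¬ IsEnd j → Digit a)

  vertex-intro : ∀ {x} → (∀ j → Admissible j (x j)) → + n ℤS.∣ totalSum x → IsVertex n m x
  vertex-intro adm n∣x = (λ j → proj₁ (adm j)) , (λ j → proj₂ (adm j)) , ℤS.∣⇒∣ᵤ n∣x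

  vertex-admissible : ∀ {x} → IsVertex n m x → ∀ j → Admissible j (x j)
  vertex-admissible (ends , inner , _) j = ends j , inner j

  inner-position : ∀ (j : Fin (suc (suc m))) → 1 ≤ toℕ j → toℕ j ≤ m → ¬ IsEnd j
  inner-position j 1≤j j≤m (inj₁ j≡0) = ℕP.<⇒≢ 1≤j (sym j≡0)
  inner-position j 1≤j j≤m (inj₂ j≡1+m) = ℕP.<⇒≱ (s≤s j≤m) (ℕP.≤-reflexive (sym j≡1+m))

  end-zero : ∀ a → + 0 ℤ.≤ a → a ℤ.< + n → + n ℤS.∣ a → a ≡ + 0
  end-zero (+ zero) _ _ _ = refl
  end-zero (+ suc k) _ (+<+ a<n) n∣a = ⊥-elim (ℕD.>⇒∤ a<n (ℤS.∣⇒∣ᵤ n∣a))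
  end-zero -[1+ k ] () _ _

  reduce : Fin (suc (suc m)) → ℤ → ℤ
  reduce j a with isEnd? n m j
  ... | yes _ = + (a ℤ.%ℕ n)
  ... | no _ = a

  reduce-inner : ∀ j a → ¬ IsEnd j → reduce j a ≡ a
  reduce-inner j a inner with isEnd? n m j
  ... | yes end = ⊥-elim (inner end)
  ... | no _ = refl

  reduce-admissible : ∀ j a → (¬ IsEnd j → Digit a) → Admissible j (reduce j a)
  reduce-admissible j a digit with isEnd? n m j
  ... | yes end = (λ _ → +≤+ z≤n , +<+ (ℤDM.n%ℕd<d a n)) , (λ inner → ⊥-elim (inner end))
  ... | no inner = (λ end → ⊥-elim (inner end)) , digit

  reduce-congruent : ∀ j a → + n ℤS.∣ (a - reduce j a)
  reduce-congruent j a with isEnd? n m j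
  ... | no _ = ℤS.divides (+ 0) (ℤP.+-inverseʳ a)
  ... | yes _ = ℤS.divides (a ℤ./ℕ n)
                  (trans (cong (_- + (a ℤ.%ℕ n)) (ℤDM.a≡a%ℕn+[a/ℕn]*n a n)) (cancel (+ (a ℤ.%ℕ n)) _))
    where
    cancel : ∀ a b → a + b - a ≡ b
    cancel = solve-∀

  reduce-≡ : ∀ j a b → a ≡ b → + n ℤS.∣ (reduce j a - b)
  reduce-≡ j a b a≡b = subst (+ n ℤS.∣_) (flip (reduce j a)) (ℤS.∣m⇒∣-m (reduce-congruent j a))
    where
    flip : ∀ r → - (a - r) ≡ r - b
    flip r = trans (ℤP.neg-distrib-+ a (- r)) (trans (cong₂ _+_ (cong -_ a≡b) (ℤP.neg-involutive r)) (ℤP.+-comm (- b) r))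

  reduce-coordEq : ∀ j a d → CoordEq n j a (reduce j (a + d) - d)
  reduce-coordEq j a d = (λ _ → ℤS.∣⇒∣ᵤ (subst (+ n ℤS.∣_) (regroup a d (reduce j (a + d))) (reduce-congruent j (a + d)))) ,
                         (λ inner → sym (trans (cong (_- d) (reduce-inner j (a + d) inner)) (cancel a d)))
    where
    regroup : ∀ a d r → a + d - r ≡ a - (r - d)
    regroup = solve-∀
    cancel : ∀ a d → a + d - d ≡ a
    cancel = solve-∀

  transfer : Tuple m → ℕ → ℤ → Tuple m
  transfer x i s j with toℕ j ℕ.≟ i | toℕ j ℕ.≟ suc i
  ... | yes _ | _ = reduce j (x j - s)
  ... | no _ | yes _ = reduce j (x j + s)
  ... | no _ | no _ = x j

  transfer-at : ∀ x i s j → toℕ j ≡ i → transfer x i s j ≡ reduce j (x j - s)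
  transfer-at x i s j j≡i with toℕ j ℕ.≟ i
  ... | yes _ = refl
  ... | no j≢i = ⊥-elim (j≢i j≡i)

  transfer-next : ∀ x i s j → toℕ j ≡ suc i → transfer x i s j ≡ reduce j (x j + s)
  transfer-next x i s j j≡1+i with toℕ j ℕ.≟ i | toℕ j ℕ.≟ suc i
  ... | yes j≡i | _ = ⊥-elim (ℕP.1+n≢n (trans (sym j≡1+i) j≡i))
  ... | no _ | yes _ = refl
  ... | no _ | no j≢1+i = ⊥-elim (j≢1+i j≡1+i)

  transfer-off : ∀ x i s j → toℕ j ≢ i → toℕ j ≢ suc i → transfer x i s j ≡ x j
  transfer-off x i s j j≢i j≢1+i with toℕ j ℕ.≟ i | toℕ j ℕ.≟ suc i
  ... | yes j≡i | _ = ⊥-elim (j≢i j≡i)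
  ... | no _ | yes j≡1+i = ⊥-elim (j≢1+i j≡1+i)
  ... | no _ | no _ = refl

  transfer-inner-at : ∀ x i s j → toℕ j ≡ i → 1 ≤ i → i ≤ m → transfer x i s j ≡ x j - s
  transfer-inner-at x i s j j≡i 1≤i i≤m =
    trans (transfer-at x i s j j≡i)
          (reduce-inner j _ (inner-position j (subst (1 ≤_) (sym j≡i) 1≤i) (subst (_≤ m) (sym j≡i) i≤m)))

  transfer-inner-next : ∀ x i s j → toℕ j ≡ suc i → suc i ≤ m → transfer x i s j ≡ x j + s
  transfer-inner-next x i s j j≡1+i 1+i≤m =
    trans (transfer-next x i s j j≡1+i)
          (reduce-inner j _ (inner-position j (subst (1 ≤_) (sym j≡1+i) (s≤s z≤n)) (subst (_≤ m) (sym j≡1+i) 1+i≤m)))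

  transfer-adj : ∀ x i s → i ≤ m → Unit s → Adj n m x (transfer x i s)
  transfer-adj x i s i≤m unit = fi , rest , edgeKind unit
    where
    fi : Fin (suc m)
    fi = fromℕ< (s≤s i≤m)
    at-i : toℕ (inject₁ fi) ≡ i
    at-i = trans (FinP.toℕ-inject₁ fi) (FinP.toℕ-fromℕ< (s≤s i≤m))
    at-1+i : toℕ (fsuc fi) ≡ suc i
    at-1+i = cong suc (FinP.toℕ-fromℕ< (s≤s i≤m))
    y : Tuple m
    y = transfer x i s
    rest : ∀ j → j ≢ inject₁ fi → j ≢ fsuc fi → x j ≡ y j
    rest j j≢i j≢1+i = sym (transfer-off x i s j (λ j≡i → j≢i (FinP.toℕ-injective (trans j≡i (sym at-i))))
                                                 (λ j≡1+i → j≢1+i (FinP.toℕ-injective (trans j≡1+i (sym at-1+i)))))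
    y-i : y (inject₁ fi) ≡ reduce (inject₁ fi) (x (inject₁ fi) - s)
    y-i = transfer-at x i s (inject₁ fi) at-i
    y-1+i : y (fsuc fi) ≡ reduce (fsuc fi) (x (fsuc fi) + s)
    y-1+i = transfer-next x i s (fsuc fi) at-1+i
    coordEq-i : ∀ d → y (inject₁ fi) ≡ reduce (inject₁ fi) (x (inject₁ fi) + d) →
                CoordEq n (inject₁ fi) (x (inject₁ fi)) (y (inject₁ fi) - d)
    coordEq-i d y≡ = subst (λ z → CoordEq n (inject₁ fi) (x (inject₁ fi)) (z - d)) (sym y≡) (reduce-coordEq _ _ d)
    coordEq-1+i : ∀ d → y (fsuc fi) ≡ reduce (fsuc fi) (x (fsuc fi) + d) →
                  CoordEq n (fsuc fi) (x (fsuc fi)) (y (fsuc fi) - d)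
    coordEq-1+i d y≡ = subst (λ z → CoordEq n (fsuc fi) (x (fsuc fi)) (z - d)) (sym y≡) (reduce-coordEq _ _ d)
    edgeKind : Unit s →
      (CoordEq n (inject₁ fi) (x (inject₁ fi)) (y (inject₁ fi) + + 1) × CoordEq n (fsuc fi) (x (fsuc fi)) (y (fsuc fi) - + 1))
      ⊎ (CoordEq n (inject₁ fi) (x (inject₁ fi)) (y (inject₁ fi) - + 1) × CoordEq n (fsuc fi) (x (fsuc fi)) (y (fsuc fi) + + 1))
    edgeKind (inj₁ refl) = inj₁ (coordEq-i -[1+ 0 ] y-i , coordEq-1+i (+ 1) y-1+i)
    edgeKind (inj₂ refl) = inj₂ (coordEq-i (+ 1) y-i , coordEq-1+i -[1+ 0 ] y-1+i)

  -- It leads to a vertex if the new inner values are digits; the total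
  -- stays ≡ 0 (mod n) along the edge.
  transfer-vertex : ∀ x i s → i ≤ m → Unit s → IsVertex n m x →
    (∀ j → toℕ j ≡ i → ¬ IsEnd j → Digit (x j - s)) →
    (∀ j → toℕ j ≡ suc i → ¬ IsEnd j → Digit (x j + s)) →
    IsVertex n m (transfer x i s)
  transfer-vertex x i s i≤m unit vx digit-i digit-1+i = vertex-intro admissible n∣total
    where
    admissible : ∀ j → Admissible j (transfer x i s j)
    admissible j with toℕ j ℕ.≟ i | toℕ j ℕ.≟ suc i
    ... | yes j≡i | _ = reduce-admissible j _ (digit-i j j≡i)
    ... | no _ | yes j≡1+i = reduce-admissible j _ (digit-1+i j j≡1+i)
    ... | no _ | no _ = vertex-admissible vx j
    n∣total : + n ℤS.∣ totalSum (transfer x i s)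
    n∣total = edge-total n m (edge n m (transfer-adj x i s i≤m unit)) (ℤS.∣ᵤ⇒∣ (proj₂ (proj₂ vx)))

  transfer-walk : ∀ x i s → i ≤ m → Unit s → IsVertex n m x →
    (∀ j → toℕ j ≡ i → ¬ IsEnd j → Digit (x j - s)) →
    (∀ j → toℕ j ≡ suc i → ¬ IsEnd j → Digit (x j + s)) →
    Walk n m x (transfer x i s) 1
  transfer-walk x i s i≤m unit vx digit-i digit-1+i =
    (transfer-vertex x i s i≤m unit vx digit-i digit-1+i , transfer-adj x i s i≤m unit) ∷ []

  vertex-resp : ∀ {y y'} → y' ≐ y → IsVertex n m y → IsVertex n m y'
  vertex-resp y'≐y vy =
    vertex-intro (λ j → subst (Admissible j) (sym (y'≐y j)) (vertex-admissible vy j))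
                 (subst (+ n ℤS.∣_) (prefix-cong _ _ (suc (suc m)) (λ j _ → sym (y'≐y j))) (ℤS.∣ᵤ⇒∣ (proj₂ (proj₂ vy))))

  adj-resp : ∀ {x y y'} → y' ≐ y → Adj n m x y → Adj n m x y'
  adj-resp y'≐y (i , rest , inj₁ (a , b)) =
    i , (λ j p q → trans (rest j p q) (sym (y'≐y j))) ,
    inj₁ (subst (λ z → CoordEq n (inject₁ i) _ (z + + 1)) (sym (y'≐y (inject₁ i))) a ,
          subst (λ z → CoordEq n (fsuc i) _ (z - + 1)) (sym (y'≐y (fsuc i))) b)
  adj-resp y'≐y (i , rest , inj₂ (a , b)) =
    i , (λ j p q → trans (rest j p q) (sym (y'≐y j))) ,
    inj₂ (subst (λ z → CoordEq n (inject₁ i) _ (z - + 1)) (sym (y'≐y (inject₁ i))) a ,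
          subst (λ z → CoordEq n (fsuc i) _ (z + + 1)) (sym (y'≐y (fsuc i))) b)

  retarget : ∀ {x y y' k} → Walk n m x y (suc k) → y' ≐ y → Walk n m x y' (suc k)
  retarget ((vy , adj) ∷ []) y'≐y = (vertex-resp y'≐y vy , adj-resp y'≐y adj) ∷ []
  retarget (step ∷ w@(_ ∷ _)) y'≐y = step ∷ retarget w y'≐y

  unit-digit : ∀ {s} → Unit s → Digit s
  unit-digit (inj₁ s≡1) = inj₂ (inj₂ s≡1)
  unit-digit (inj₂ s≡-1) = inj₁ s≡-1

  digit-cases : ∀ {a} → Digit a → a ≡ + 0 ⊎ Unit a
  digit-cases (inj₁ a≡-1) = inj₂ (inj₂ a≡-1)
  digit-cases (inj₂ (inj₁ a≡0)) = inj₁ a≡0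
  digit-cases (inj₂ (inj₂ a≡1)) = inj₂ (inj₁ a≡1)

  unit-neg : ∀ {s} → Unit s → Unit (- s)
  unit-neg (inj₁ refl) = inj₂ refl
  unit-neg (inj₂ refl) = inj₁ refl

  -- A vertex vanishing at 0, …, m vanishes: n ∣ u_{m+1} and 0 ≤ u_{m+1} < n.
  zero-vertex : ∀ {f} → IsVertex n m f → (∀ j → toℕ j ≤ m → f j ≡ + 0) → f ≐ zeroV
  zero-vertex {f} vf low j with ℕP.m≤n⇒m<n∨m≡n (ℕP.≤-pred (FinP.toℕ<n j))
  ... | inj₁ j<1+m = low j (ℕP.≤-pred j<1+m)
  ... | inj₂ j≡1+m = end-zero (f j) (proj₁ range) (proj₂ range) (subst (+ n ℤS.∣_) total≡ (ℤS.∣ᵤ⇒∣ (proj₂ (proj₂ vf))))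
    where
    range : (+ 0 ℤ.≤ f j) × (f j ℤ.< + n)
    range = proj₁ (vertex-admissible vf j) (inj₂ j≡1+m)
    1+m<2+m : suc m < suc (suc m)
    1+m<2+m = ℕP.n<1+n _
    last≡j : fromℕ< 1+m<2+m ≡ j
    last≡j = FinP.toℕ-injective (trans (FinP.toℕ-fromℕ< 1+m<2+m) (sym j≡1+m))
    total≡ : totalSum f ≡ f j
    total≡ = begin
      totalSum f                                      ≡⟨ prefix-snoc f (suc m) 1+m<2+m ⟩
      prefix f (suc m) + f (fromℕ< 1+m<2+m)           ≡⟨ cong₂ _+_ (prefix-cong f zeroV (suc m) (λ j' j'<1+m → low j' (ℕP.≤-pred j'<1+m)))
                                                                  (cong f last≡j) ⟩
      prefix (zeroV {m}) (suc m) + f j                ≡⟨ cong (_+ f j) (prefix-zero zeroV (λ _ → refl) (suc m)) ⟩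
      + 0 + f j                                       ≡⟨ ℤP.+-identityˡ (f j) ⟩
      f j                                             ∎
      where open ≡-Reasoning

  -- A unit s at an inner position q, with zeros at 1, …, q - 1, is carried
  -- to position 0 in q steps: afterwards 1, …, q vanish and u_0 ≡ x_0 + s.
  record LeftCarry (q : ℕ) (x : Tuple m) (s : ℤ) : Set where
    field
      target : Tuple m
      walk : Walk n m x target q
      at-0 : ∀ j → toℕ j ≡ 0 → + n ℤS.∣ (target j - (x j + s))
      cleared : ∀ j → 1 ≤ toℕ j → toℕ j ≤ q → target j ≡ + 0
      above : ∀ j → q < toℕ j → target j ≡ x j

  left-step : ∀ q' → suc q' ≤ m → ∀ x s → Unit s → IsVertex n m x →
    (∀ j → toℕ j ≡ suc q' → x j ≡ s) → (∀ j → 1 ≤ toℕ j → toℕ j < suc q' → x j ≡ + 0) →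
    Walk n m x (transfer x q' (- s)) 1
  left-step q' q≤m x s unit vx x-q zeros = transfer-walk x q' (- s) (ℕP.<⇒≤ q≤m) (unit-neg unit) vx
    (λ j j≡q' inner → subst Digit (sym (arrives j j≡q' (inner⇒1≤ j inner))) (unit-digit unit))
    (λ j j≡q _ → inj₂ (inj₁ (trans (cong (_+ - s) (x-q j j≡q)) (ℤP.+-inverseʳ s))))
    where
    inner⇒1≤ : ∀ j → ¬ IsEnd j → 1 ≤ toℕ j
    inner⇒1≤ j inner = ℕP.n≢0⇒n>0 (λ j≡0 → inner (inj₁ j≡0))
    arrives : ∀ j → toℕ j ≡ q' → 1 ≤ toℕ j → x j - - s ≡ s
    arrives j j≡q' 1≤j = trans (cong (_- - s) (zeros j 1≤j (subst (_< suc q') (sym j≡q') ℕP.≤-refl)))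
                               (trans (ℤP.+-identityˡ (- - s)) (ℤP.neg-involutive s))

  left-step-vacates : ∀ q' → suc q' ≤ m → ∀ x s → (∀ j → toℕ j ≡ suc q' → x j ≡ s) →
                      ∀ j → toℕ j ≡ suc q' → transfer x q' (- s) j ≡ + 0
  left-step-vacates q' q≤m x s x-q j j≡q =
    trans (transfer-inner-next x q' (- s) j j≡q q≤m) (trans (cong (_+ - s) (x-q j j≡q)) (ℤP.+-inverseʳ s))

  left-carry-extend : ∀ q' → 1 ≤ q' → suc q' ≤ m → ∀ x s → (∀ j → toℕ j ≡ suc q' → x j ≡ s) →
    Walk n m x (transfer x q' (- s)) 1 → LeftCarry q' (transfer x q' (- s)) s → LeftCarry (suc q') x s
  left-carry-extend q' 1≤q' q≤m x s x-q step rest = record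
    { target = target ; walk = step ++ʷ walk
    ; at-0 = λ j j≡0 → subst (λ z → + n ℤS.∣ (target j - (z + s)))
                              (y-off j (λ j≡q' → ℕP.<⇒≢ 1≤q' (sym (trans (sym j≡q') j≡0))) (λ j≡q → ℕP.1+n≢0 (trans (sym j≡q) j≡0)))
                              (at-0 j j≡0)
    ; cleared = λ j 1≤j j≤q →
        [ (λ j<q → cleared j 1≤j (ℕP.≤-pred j<q))
        , (λ j≡q → trans (above j (subst (q' <_) (sym j≡q) ℕP.≤-refl)) (left-step-vacates q' q≤m x s x-q j j≡q))
        ]′ (ℕP.m≤n⇒m<n∨m≡n j≤q)
    ; above = λ j q<j → trans (above j (ℕP.<-trans (ℕP.n<1+n q') q<j))
                             (y-off j (λ j≡q' → ℕP.<⇒≢ (ℕP.<-trans (ℕP.n<1+n q') q<j) (sym j≡q')) (λ j≡q → ℕP.<⇒≢ q<j (sym j≡q))) }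
    where
    open LeftCarry rest
    y-off : ∀ j → toℕ j ≢ q' → toℕ j ≢ suc q' → transfer x q' (- s) j ≡ x j
    y-off = transfer-off x q' (- s)

  carry-left : ∀ q → 1 ≤ q → q ≤ m → ∀ x s → Unit s → IsVertex n m x →
               (∀ j → toℕ j ≡ q → x j ≡ s) → (∀ j → 1 ≤ toℕ j → toℕ j < q → x j ≡ + 0) →
               LeftCarry q x s
  carry-left (suc zero) _ 1≤m x s unit vx x-1 zeros = record
    { target = y ; walk = left-step 0 1≤m x s unit vx x-1 zeros
    ; at-0 = λ j j≡0 → subst (λ z → + n ℤS.∣ (z - (x j + s))) (sym (transfer-at x 0 (- s) j j≡0))
                              (reduce-≡ j _ _ (cong (λ z → x j + z) (ℤP.neg-involutive s)))
    ; cleared = λ j 1≤j j≤1 → left-step-vacates 0 1≤m x s x-1 j (ℕP.≤-antisym j≤1 1≤j)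
    ; above = λ j 1<j → transfer-off x 0 (- s) j (λ j≡0 → ℕP.<⇒≢ (ℕP.<-trans (s≤s z≤n) 1<j) (sym j≡0))
                                                       (λ j≡1 → ℕP.<⇒≢ 1<j (sym j≡1)) }
    where
    y : Tuple m
    y = transfer x 0 (- s)
  carry-left (suc q'@(suc _)) _ q≤m x s unit vx x-q zeros =
    left-carry-extend q' (s≤s z≤n) q≤m x s x-q step
      (carry-left q' (s≤s z≤n) (ℕP.<⇒≤ q≤m) y s unit (walk-vertex vx step) y-q' y-zeros)
    where
    y : Tuple m
    y = transfer x q' (- s)
    step : Walk n m x y 1
    step = left-step q' q≤m x s unit vx x-q zeros
    y-q' : ∀ j → toℕ j ≡ q' → y j ≡ s
    y-q' j j≡q' = trans (transfer-inner-at x q' (- s) j j≡q' (s≤s z≤n) (ℕP.<⇒≤ q≤m))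
                        (trans (cong (_- - s) (zeros j (subst (1 ≤_) (sym j≡q') (s≤s z≤n)) (subst (_< suc q') (sym j≡q') ℕP.≤-refl)))
                               (trans (ℤP.+-identityˡ (- - s)) (ℤP.neg-involutive s)))
    y-zeros : ∀ j → 1 ≤ toℕ j → toℕ j < q' → y j ≡ + 0
    y-zeros j 1≤j j<q' = trans (transfer-off x q' (- s) j (ℕP.<⇒≢ j<q') (ℕP.<⇒≢ (ℕP.<-trans j<q' (ℕP.n<1+n q'))))
                               (zeros j 1≤j (ℕP.<-trans j<q' (ℕP.n<1+n q')))

  -- Symmetrically, a unit at position q with zeros at q + 1, …, m is carried
  -- past position m in m + 1 - q steps, leaving zeros at q, …, m.
  record RightCarry (q len : ℕ) (x : Tuple m) : Set where
    field
      target : Tuple m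
      walk : Walk n m x target len
      cleared : ∀ j → q ≤ toℕ j → toℕ j ≤ m → target j ≡ + 0
      below : ∀ j → toℕ j < q → target j ≡ x j

  right-step : ∀ q → 1 ≤ q → q ≤ m → ∀ x s → Unit s → IsVertex n m x →
    (∀ j → toℕ j ≡ q → x j ≡ s) → (∀ j → q < toℕ j → toℕ j ≤ m → x j ≡ + 0) →
    Walk n m x (transfer x q s) 1
  right-step q 1≤q q≤m x s unit vx x-q zeros = transfer-walk x q s q≤m unit vx
    (λ j j≡q _ → inj₂ (inj₁ (trans (cong (_- s) (x-q j j≡q)) (ℤP.+-inverseʳ s))))
    (λ j j≡1+q inner → subst Digit (sym (arrives j j≡1+q (inner≤m j inner))) (unit-digit unit))
    where
    inner≤m : ∀ j → ¬ IsEnd j → toℕ j ≤ m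
    inner≤m j inner = ℕP.≤-pred (ℕP.≤∧≢⇒< (ℕP.≤-pred (FinP.toℕ<n j)) (λ j≡1+m → inner (inj₂ j≡1+m)))
    arrives : ∀ j → toℕ j ≡ suc q → toℕ j ≤ m → x j + s ≡ s
    arrives j j≡1+q j≤m = trans (cong (_+ s) (zeros j (subst (q <_) (sym j≡1+q) ℕP.≤-refl) j≤m)) (ℤP.+-identityˡ s)

  right-step-vacates : ∀ q → 1 ≤ q → q ≤ m → ∀ x s → (∀ j → toℕ j ≡ q → x j ≡ s) →
                       ∀ j → toℕ j ≡ q → transfer x q s j ≡ + 0
  right-step-vacates q 1≤q q≤m x s x-q j j≡q =
    trans (transfer-inner-at x q s j j≡q 1≤q q≤m) (trans (cong (_- s) (x-q j j≡q)) (ℤP.+-inverseʳ s))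

  right-carry-extend : ∀ q → 1 ≤ q → q ≤ m → ∀ x s → (∀ j → toℕ j ≡ q → x j ≡ s) → ∀ {len} →
    Walk n m x (transfer x q s) 1 → RightCarry (suc q) len (transfer x q s) → RightCarry q (suc len) x
  right-carry-extend q 1≤q q≤m x s x-q step rest = record
    { target = target ; walk = step ++ʷ walk
    ; cleared = λ j q≤j j≤m →
        [ (λ q<j → cleared j q<j j≤m)
        , (λ q≡j → trans (below j (subst (_< suc q) q≡j ℕP.≤-refl)) (right-step-vacates q 1≤q q≤m x s x-q j (sym q≡j)))
        ]′ (ℕP.m≤n⇒m<n∨m≡n q≤j)
    ; below = λ j j<q → trans (below j (ℕP.m<n⇒m<1+n j<q))
                             (transfer-off x q s j (ℕP.<⇒≢ j<q) (ℕP.<⇒≢ (ℕP.m<n⇒m<1+n j<q))) }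
    where open RightCarry rest

  carry-right : ∀ d q → q ℕ.+ d ≡ m → 1 ≤ q → ∀ x s → Unit s → IsVertex n m x →
                (∀ j → toℕ j ≡ q → x j ≡ s) → (∀ j → q < toℕ j → toℕ j ≤ m → x j ≡ + 0) →
                RightCarry q (suc d) x
  carry-right zero q q+0≡m 1≤q x s unit vx x-q zeros = record
    { target = transfer x q s ; walk = right-step q 1≤q q≤m x s unit vx x-q zeros
    ; cleared = λ j q≤j j≤m → right-step-vacates q 1≤q q≤m x s x-q j (ℕP.≤-antisym (subst (toℕ j ≤_) (sym q≡m) j≤m) q≤j)
    ; below = λ j j<q → transfer-off x q s j (ℕP.<⇒≢ j<q) (ℕP.<⇒≢ (ℕP.m<n⇒m<1+n j<q)) }
    where
    q≡m : q ≡ m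
    q≡m = trans (sym (ℕP.+-identityʳ q)) q+0≡m
    q≤m : q ≤ m
    q≤m = ℕP.≤-reflexive q≡m
  carry-right (suc d) q q+1+d≡m 1≤q x s unit vx x-q zeros =
    right-carry-extend q 1≤q (ℕP.<⇒≤ 1+q≤m) x s x-q step
      (carry-right d (suc q) (trans (sym (ℕP.+-suc q d)) q+1+d≡m) (s≤s z≤n) y s unit (walk-vertex vx step) y-1+q y-zeros)
    where
    1+q≤m : suc q ≤ m
    1+q≤m = subst (suc q ≤_) (trans (sym (ℕP.+-suc q d)) q+1+d≡m) (s≤s (ℕP.m≤m+n q d))
    y : Tuple m
    y = transfer x q s
    step : Walk n m x y 1
    step = right-step q 1≤q (ℕP.<⇒≤ 1+q≤m) x s unit vx x-q zeros
    y-1+q : ∀ j → toℕ j ≡ suc q → y j ≡ s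
    y-1+q j j≡1+q = trans (transfer-inner-next x q s j j≡1+q 1+q≤m)
                          (trans (cong (_+ s) (zeros j (subst (q <_) (sym j≡1+q) ℕP.≤-refl) (subst (_≤ m) (sym j≡1+q) 1+q≤m)))
                                 (ℤP.+-identityˡ s))
    y-zeros : ∀ j → suc q < toℕ j → toℕ j ≤ m → y j ≡ + 0
    y-zeros j 1+q<j j≤m = trans (transfer-off x q s j (λ j≡q → ℕP.<⇒≢ (ℕP.<-trans (ℕP.n<1+n q) 1+q<j) (sym j≡q))
                                                      (λ j≡1+q → ℕP.<⇒≢ 1+q<j (sym j≡1+q)))
                                (zeros j (ℕP.<-trans (ℕP.n<1+n q) 1+q<j) j≤m)

  at-position : ∀ {b} (b<2+m : b < suc (suc m)) j → toℕ j ≡ b → j ≡ fromℕ< b<2+m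
  at-position b<2+m j j≡b = FinP.toℕ-injective (trans j≡b (sym (FinP.toℕ-fromℕ< b<2+m)))

  -- Clearing positions b, …, m (from the top down, carrying each unit past
  -- m) takes at most tri (m + 1 - b) steps.
  record ClearedAbove (b r : ℕ) (w : Tuple m) : Set where
    field
      target : Tuple m
      len : ℕ
      len≤ : len ≤ tri r
      walk : Walk n m w target len
      cleared : ∀ j → b ≤ toℕ j → toℕ j ≤ m → target j ≡ + 0
      below : ∀ j → toℕ j < b → target j ≡ w j

  clear-above : ∀ r b → b ℕ.+ r ≡ suc m → 1 ≤ b → ∀ w → IsVertex n m w → ClearedAbove b r w
  clear-above zero b b+0≡1+m _ w _ = record
    { target = w ; len = 0 ; len≤ = z≤n ; walk = []
    ; cleared = λ j b≤j j≤m → ⊥-elim (ℕP.<⇒≱ (s≤s j≤m) (subst (_≤ toℕ j) (trans (sym (ℕP.+-identityʳ b)) b+0≡1+m) b≤j))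
    ; below = λ _ _ → refl }
  clear-above (suc r) b b+1+r≡1+m 1≤b w vw = at-b (digit-cases (proj₂ (vertex-admissible vz fb) b-inner))
    where
    b+r≡m : b ℕ.+ r ≡ m
    b+r≡m = ℕP.suc-injective (trans (sym (ℕP.+-suc b r)) b+1+r≡1+m)
    b≤m : b ≤ m
    b≤m = subst (b ≤_) b+r≡m (ℕP.m≤m+n b r)
    b<2+m : b < suc (suc m)
    b<2+m = ℕP.m≤n⇒m≤1+n (s≤s b≤m)
    fb : Fin (suc (suc m))
    fb = fromℕ< b<2+m
    b-inner : ¬ IsEnd fb
    b-inner = inner-position fb (subst (1 ≤_) (sym (FinP.toℕ-fromℕ< b<2+m)) 1≤b)
                                    (subst (_≤ m) (sym (FinP.toℕ-fromℕ< b<2+m)) b≤m)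
    open ClearedAbove (clear-above r (suc b) (trans (sym (ℕP.+-suc b r)) b+1+r≡1+m) (s≤s z≤n) w vw)
      renaming (target to z)
    vz : IsVertex n m z
    vz = walk-vertex vw walk
    at-b : z fb ≡ + 0 ⊎ Unit (z fb) → ClearedAbove b (suc r) w
    at-b (inj₁ z-b≡0) = record
      { target = z ; len = len ; len≤ = ℕP.m≤n⇒m≤n+o (suc r) len≤ ; walk = walk
      ; cleared = λ j b≤j j≤m → [ (λ b<j → cleared j b<j j≤m)
                                 , (λ b≡j → trans (cong z (at-position b<2+m j (sym b≡j))) z-b≡0) ]′ (ℕP.m≤n⇒m<n∨m≡n b≤j)
      ; below = λ j j<b → below j (ℕP.m<n⇒m<1+n j<b) }
    at-b (inj₂ unit) = record
      { target = RC.target ; len = len ℕ.+ suc r ; len≤ = ℕP.+-monoˡ-≤ (suc r) len≤ ; walk = walk ++ʷ RC.walk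
      ; cleared = RC.cleared
      ; below = λ j j<b → trans (RC.below j j<b) (below j (ℕP.m<n⇒m<1+n j<b)) }
      where
      module RC = RightCarry (carry-right r b b+r≡m 1≤b z (z fb) unit vz
                                (λ j j≡b → cong z (at-position b<2+m j j≡b)) (λ j b<j j≤m → cleared j b<j j≤m))

  -- Clearing positions 1, …, r (from the bottom up, carrying each unit into
  -- position 0) takes at most tri r steps and leaves u_0 ≡ P_{r+1}(w).
  record ClearedBelow (r : ℕ) (w : Tuple m) : Set where
    field
      target : Tuple m
      len : ℕ
      len≤ : len ≤ tri r
      walk : Walk n m w target len
      at-0 : ∀ j → toℕ j ≡ 0 → + n ℤS.∣ (target j - prefix w (suc r))
      cleared : ∀ j → 1 ≤ toℕ j → toℕ j ≤ r → target j ≡ + 0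
      above : ∀ j → r < toℕ j → target j ≡ w j

  clear-below : ∀ r → r ≤ m → ∀ w → IsVertex n m w → ClearedBelow r w
  clear-below zero _ w _ = record
    { target = w ; len = 0 ; len≤ = z≤n ; walk = []
    ; at-0 = λ j j≡0 → ℤS.divides (+ 0) (at-first j (FinP.toℕ-injective {j = fzero} j≡0))
    ; cleared = λ j 1≤j j≤0 → ⊥-elim (ℕP.<⇒≱ 1≤j j≤0)
    ; above = λ _ _ → refl }
    where
    at-first : ∀ j → j ≡ fzero → w j - prefix w 1 ≡ + 0 * + n
    at-first j refl = trans (cong (λ t → w fzero - t) (ℤP.+-identityʳ (w fzero))) (ℤP.+-inverseʳ (w fzero))
  clear-below (suc r') r≤m w vw = at-r (digit-cases (proj₂ (vertex-admissible vz fr) r-inner))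
    where
    r : ℕ
    r = suc r'
    r<2+m : r < suc (suc m)
    r<2+m = ℕP.m≤n⇒m≤1+n (s≤s r≤m)
    fr : Fin (suc (suc m))
    fr = fromℕ< r<2+m
    r-inner : ¬ IsEnd fr
    r-inner = inner-position fr (subst (1 ≤_) (sym (FinP.toℕ-fromℕ< r<2+m)) (s≤s z≤n))
                                    (subst (_≤ m) (sym (FinP.toℕ-fromℕ< r<2+m)) r≤m)
    open ClearedBelow (clear-below r' (ℕP.<⇒≤ r≤m) w vw) renaming (target to z)
    vz : IsVertex n m z
    vz = walk-vertex vw walk
    z-r≡w-r : z fr ≡ w fr
    z-r≡w-r = above fr (subst (r' <_) (sym (FinP.toℕ-fromℕ< r<2+m)) ℕP.≤-refl)
    prefix-r : prefix w (suc r) ≡ prefix w r + z fr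
    prefix-r = trans (prefix-snoc w r r<2+m) (cong (λ t → prefix w r + t) (sym z-r≡w-r))
    at-r : z fr ≡ + 0 ⊎ Unit (z fr) → ClearedBelow r w
    at-r (inj₁ z-r≡0) = record
      { target = z ; len = len ; len≤ = ℕP.m≤n⇒m≤n+o r len≤ ; walk = walk
      ; at-0 = λ j j≡0 → subst (λ t → + n ℤS.∣ (z j - t))
                                (sym (trans prefix-r (trans (cong (λ t → prefix w r + t) z-r≡0) (ℤP.+-identityʳ _))))
                                (at-0 j j≡0)
      ; cleared = λ j 1≤j j≤r → [ (λ j<r → cleared j 1≤j (ℕP.≤-pred j<r))
                                 , (λ j≡r → trans (cong z (at-position r<2+m j j≡r)) z-r≡0) ]′ (ℕP.m≤n⇒m<n∨m≡n j≤r)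
      ; above = λ j r<j → above j (ℕP.<-trans (ℕP.n<1+n r') r<j) }
    at-r (inj₂ unit) = record
      { target = LC.target ; len = len ℕ.+ r ; len≤ = ℕP.+-monoˡ-≤ r len≤ ; walk = walk ++ʷ LC.walk
      ; at-0 = λ j j≡0 → subst (λ t → + n ℤS.∣ (LC.target j - t)) (sym prefix-r)
                                (subst (+ n ℤS.∣_) (recombine (LC.target j) (z j) (prefix w r) (z fr))
                                       (ℤS.∣m∣n⇒∣m+n (LC.at-0 j j≡0) (at-0 j j≡0)))
      ; cleared = LC.cleared
      ; above = λ j r<j → trans (LC.above j r<j) (above j (ℕP.<-trans (ℕP.n<1+n r') r<j)) }
      where
      module LC = LeftCarry (carry-left r (s≤s z≤n) r≤m z (z fr) unit vz
                               (λ j j≡r → cong z (at-position r<2+m j j≡r)) (λ j 1≤j j<r → cleared j 1≤j (ℕP.≤-pred j<r)))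
      recombine : ∀ t z p s → (t - (z + s)) + (z - p) ≡ t - (p + s)
      recombine = solve-∀

  -- From a vertex with a pivot q + 1 (n ∣ P_{q+1}(v)) a tuple pointwise equal
  -- to 0 is reached in at most tri q + tri (m - q) steps: clear q + 1, …, m
  -- upwards, then 1, …, q into position 0, which then vanishes by the pivot.
  pivot-walk : ∀ v → IsVertex n m v → ∀ q → q ≤ m → + n ℤS.∣ prefix v (suc q) →
    Σ (Tuple m) λ f → Σ ℕ λ len → len ≤ tri q ℕ.+ tri (m ℕ.∸ q) × Walk n m v f len × f ≐ zeroV
  pivot-walk v vv q q≤m pivot =
    CB.target , CA.len ℕ.+ CB.len ,
    subst (CA.len ℕ.+ CB.len ≤_) (ℕP.+-comm (tri (m ℕ.∸ q)) (tri q)) (ℕP.+-mono-≤ CA.len≤ CB.len≤) ,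
    CA.walk ++ʷ CB.walk , zero-vertex (walk-vertex vz CB.walk) vanishes
    where
    module CA = ClearedAbove (clear-above (m ℕ.∸ q) (suc q) (cong suc (ℕP.m+[n∸m]≡n q≤m)) (s≤s z≤n) v vv)
    vz : IsVertex n m CA.target
    vz = walk-vertex vv CA.walk
    module CB = ClearedBelow (clear-below q q≤m CA.target vz)
    same-prefix : prefix CA.target (suc q) ≡ prefix v (suc q)
    same-prefix = prefix-cong CA.target v (suc q) CA.below
    first : ∀ j → toℕ j ≡ 0 → CB.target j ≡ + 0
    first j j≡0 = end-zero (CB.target j) (proj₁ range) (proj₂ range)
                    (subst (+ n ℤS.∣_) (cancel (CB.target j) (prefix v (suc q)))
                           (ℤS.∣m∣n⇒∣m+n (subst (λ t → + n ℤS.∣ (CB.target j - t)) same-prefix (CB.at-0 j j≡0)) pivot))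
      where
      range : (+ 0 ℤ.≤ CB.target j) × (CB.target j ℤ.< + n)
      range = proj₁ (vertex-admissible (walk-vertex vz CB.walk) j) (inj₁ j≡0)
      cancel : ∀ a b → (a - b) + b ≡ a
      cancel = solve-∀
    vanishes : ∀ j → toℕ j ≤ m → CB.target j ≡ + 0
    vanishes j j≤m with toℕ j ℕ.≟ 0 | ℕP.≤-<-connex (toℕ j) q
    ... | yes j≡0 | _ = first j j≡0
    ... | no j≢0 | inj₁ j≤q = CB.cleared j (ℕP.n≢0⇒n>0 j≢0) j≤q
    ... | no _ | inj₂ q<j = trans (CB.above j q<j) (CA.cleared j q<j j≤m)

  -- Turning such a walk into a distance bound; a walk of length 0 (v is 0
  -- pointwise) is replaced by the detour moving a unit out of position m and
  -- back, which is why K ≥ 2 is needed.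
  distance-bound : ∀ v → IsVertex n m v → 1 ≤ m → ∀ f len K → Walk n m v f len → f ≐ zeroV →
                   len ≤ K → 2 ≤ K → DistAtMost n m v zeroV K
  distance-bound v vv _ f (suc len) K w f≐0 len≤K _ = suc len , len≤K , retarget w (λ j → sym (f≐0 j))
  distance-bound v vv 1≤m .v zero K [] v≐0 _ 2≤K = 2 , 2≤K , retarget (out ++ʷ back) (λ j → sym (y₂≐0 j))
    where
    y₁ y₂ : Tuple m
    y₁ = transfer v m -[1+ 0 ]
    y₂ = transfer y₁ m (+ 1)
    y₁-m : ∀ j → toℕ j ≡ m → y₁ j ≡ + 1
    y₁-m j j≡m = trans (transfer-inner-at v m -[1+ 0 ] j j≡m 1≤m ℕP.≤-refl) (cong (_- -[1+ 0 ]) (v≐0 j))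
    out : Walk n m v y₁ 1
    out = transfer-walk v m -[1+ 0 ] ℕP.≤-refl (inj₂ refl) vv
            (λ j j≡m _ → inj₂ (inj₂ (cong (_- -[1+ 0 ]) (v≐0 j))))
            (λ j j≡1+m inner → ⊥-elim (inner (inj₂ j≡1+m)))
    back : Walk n m y₁ y₂ 1
    back = transfer-walk y₁ m (+ 1) ℕP.≤-refl (inj₁ refl) (walk-vertex vv out)
             (λ j j≡m _ → inj₂ (inj₁ (cong (_- + 1) (y₁-m j j≡m))))
             (λ j j≡1+m inner → ⊥-elim (inner (inj₂ j≡1+m)))
    y₂≐0 : y₂ ≐ zeroV
    y₂≐0 = zero-vertex (walk-vertex vv (out ++ʷ back)) low
      where
      low : ∀ j → toℕ j ≤ m → y₂ j ≡ + 0
      low j j≤m with ℕP.m≤n⇒m<n∨m≡n j≤m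
      ... | inj₂ j≡m = trans (transfer-inner-at y₁ m (+ 1) j j≡m 1≤m ℕP.≤-refl) (cong (_- + 1) (y₁-m j j≡m))
      ... | inj₁ j<m = trans (transfer-off y₁ m (+ 1) j (ℕP.<⇒≢ j<m) (ℕP.<⇒≢ (ℕP.m<n⇒m<1+n j<m)))
                             (trans (transfer-off v m -[1+ 0 ] j (ℕP.<⇒≢ j<m) (ℕP.<⇒≢ (ℕP.m<n⇒m<1+n j<m))) (v≐0 j))

  pivot-distance : ∀ v → IsVertex n m v → 1 ≤ m → ∀ q → q ≤ m → + n ℤS.∣ prefix v (suc q) →
                   ∀ K → tri q ℕ.+ tri (m ℕ.∸ q) ≤ K → 2 ≤ K → DistAtMost n m v zeroV K
  pivot-distance v vv 1≤m q q≤m pivot K cost≤K 2≤K with pivot-walk v vv q q≤m pivot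
  ... | f , len , len≤ , walk , f≐0 = distance-bound v vv 1≤m f len K walk f≐0 (ℕP.≤-trans len≤ cost≤K) 2≤K

minList-< : ∀ {a} l T → a ∈ l → minList l < T → Σ ℕ λ y → y ∈ l × y < T
minList-< (x ∷ xs) T _ = go x xs
  where
  go : ∀ x xs → foldr ℕ._⊓_ x xs < T → Σ ℕ λ y → y ∈ x ∷ xs × y < T
  go x [] x<T = x , here refl , x<T
  go x (y ∷ ys) min<T with ℕP.⊓-sel y (foldr ℕ._⊓_ x ys)
  ... | inj₁ min≡y = y , there (here refl) , subst (_< T) min≡y min<T
  ... | inj₂ min≡rest with go x ys (subst (_< T) min≡rest min<T)
  ...   | z , here z≡x , z<T = z , here z≡x , z<T
  ...   | z , there z∈ys , z<T = z , there (there z∈ys) , z<T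

twiceDist-first : ∀ m → twiceDist m 0 ≡ suc (suc m)
twiceDist-first m = cong ∣_∣ (outer (+ m))
  where
  outer : ∀ m → + 2 * (+ 0 - + 1) - m ≡ - (+ 2 + m)
  outer = solve-∀

twiceDist-last : ∀ m → twiceDist m (suc (suc m)) ≡ suc (suc m)
twiceDist-last m = cong ∣_∣ (outer (+ m))
  where
  outer : ∀ m → + 2 * ((+ 2 + m) - + 1) - m ≡ + 2 + m
  outer = solve-∀

outer-far : ∀ n m → n ≤ m → ∀ p' → twiceDist m p' ≡ suc (suc m) → ¬ twiceDist m p' < twiceHnm n m
outer-far n m n≤m p' td≡ td<T =
  ℕP.<⇒≱ td<T (subst (twiceHnm n m ≤_) (sym td≡) (ℕP.m≤n⇒m≤1+n (ℕP.≤-trans twiceHnm≤1+n (s≤s n≤m))))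
  where
  twiceHnm≤1+n : twiceHnm n m ≤ suc n
  twiceHnm≤1+n = either (2 ℕD.∣? ∣ + m - + n ∣)
    where
    either : (d : Dec (2 ℕD.∣ ∣ + m - + n ∣)) → (if does d then n else suc n) ≤ suc n
    either (yes _) = ℕP.n≤1+n n
    either (no _) = ℕP.≤-refl

pivot? : ∀ n m (v : Tuple m) p' → Dec (n ℕD.∣ ∣ prefixSum v p' ∣)
pivot? n m v p' = n ℕD.∣? ∣ prefixSum v p' ∣

-- A pivot closer to m/2 than h_{n,m} (with n ≤ m) is one of 0, …, m: the
-- outer pivots -1 and m + 1 lie at distance (m + 2)/2 > h_{n,m}.
pivot-inner : ∀ n m → n ≤ m → (v : Tuple m) → ∀ p' → p' < suc (suc (suc m)) →
  + n ℤS.∣ prefix v p' → twiceDist m p' < twiceHnm n m →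
  Σ ℕ λ q → q ≤ m × (+ n ℤS.∣ prefix v (suc q)) × twiceDist m (suc q) < twiceHnm n m
pivot-inner n m n≤m v zero _ _ td<T = ⊥-elim (outer-far n m n≤m 0 (twiceDist-first m) td<T)
pivot-inner n m n≤m v (suc q) (s≤s q<2+m) n∣ td<T with ℕP.m≤n⇒m<n∨m≡n (ℕP.≤-pred q<2+m)
... | inj₁ q<1+m = q , ℕP.≤-pred q<1+m , n∣ , td<T
... | inj₂ refl = ⊥-elim (outer-far n m n≤m (suc (suc m)) (twiceDist-last m) td<T)

-- If h(v) < h_{n,m} (and n ≤ m), some pivot q ∈ {0, …, m} (encoded as q + 1)
-- witnesses it; the list of pivots is nonempty as -1 is always a pivot.
inner-pivot : ∀ n m .{{_ : NonZero n}} → n ≤ m → (v : Tuple m) → twiceH n m v < twiceHnm n m →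
  Σ ℕ λ q → q ≤ m × (+ n ℤS.∣ prefix v (suc q)) × twiceDist m (suc q) < twiceHnm n m
inner-pivot n m n≤m v h<
  with minList-< (map (twiceDist m) (pivots n m v)) (twiceHnm n m)
                 (∈-map⁺ (twiceDist m) (∈-filter⁺ (pivot? n m v) (∈-upTo⁺ (s≤s z≤n)) (n ℕD.∣0))) h<
... | y , y∈ , y<T with ∈-map∘filter⁻ (twiceDist m) (pivot? n m v) {xs = upTo (suc (suc (suc m)))} y∈
... | p' , p'∈ , refl , n∣ = pivot-inner n m n≤m v p' (∈-upTo⁻ p'∈) (ℤS.∣ᵤ⇒∣ n∣) y<T

dList-head : ∀ n m .{{_ : NonZero n}} → Σ (List (Tuple m × Tuple m)) λ rest → dList n m ≡ (u0 n m , zeroV) ∷ rest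
dList-head n m = by-parity (2 ℕD.∣? ∣ + m - + n ∣)
  where
  by-parity : (d : Dec (2 ℕD.∣ ∣ + m - + n ∣)) → Σ (List (Tuple m × Tuple m)) λ rest →
    (if does d then (u0 n m , zeroV) ∷ [] else (u0 n m , zeroV) ∷ (u1 n m , zeroV) ∷ []) ≡ (u0 n m , zeroV) ∷ rest
  by-parity (yes _) = [] , refl
  by-parity (no _) = (u1 n m , zeroV) ∷ [] , refl

lemma5p24 : (n m : ℕ) .{{_ : NonZero n}} → 1 < n → n ≤ m →
    (v : Tuple m) → IsVertex n m v → twiceH n m v < twiceHnm n m →
    DistLeMax n m v zeroV ((u0 n m , zeroV) ∷ []) ×
    DistLeMax n m (u0 n m) zeroV (dList n m)
lemma5p24 n m 1<n n≤m v vv h< = v-below-u0 , u0-in-dList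
  where
  2≤m : 2 ≤ m
  2≤m = ℕP.≤-trans 1<n n≤m
  -- d(v, 0) ≤ d(u^0, 0): a walk u^0 → 0 of length j ≤ k gives j ≥ Φ_e(u^0)
  -- with n ∣ e, and Φ_e(u^0) ≥ 2 bounds the cost of clearing v around the
  -- pivot provided by h(v) < h_{n,m}.
  v-below-u0 : DistLeMax n m v zeroV ((u0 n m , zeroV) ∷ [])
  v-below-u0 k ((j , j≤k , w) ∷ _) with potential-walk n m w | inner-pivot n m n≤m v h<
  ... | e , n∣e , Φ≤j | q , q≤m , pivot , below =
    pivot-distance n m v vv (ℕP.<⇒≤ 2≤m) q q≤m pivot k
      (ℕP.≤-trans (pivot-cost≤potential-u0 n m n≤m q q≤m below e n∣e) Φ≤k)
      (ℕP.≤-trans (potential-u0≥2 n m 2≤m e) Φ≤k)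
    where
    Φ≤k : potential n m (u0 n m) e ≤ k
    Φ≤k = ℕP.≤-trans Φ≤j j≤k
  -- d_{n,m} ≥ d^0_{n,m}: the pairs defining d_{n,m} include (u^0, 0).
  u0-in-dList : DistLeMax n m (u0 n m) zeroV (dList n m)
  u0-in-dList k bounds with dList-head n m
  ... | rest , dList≡ = All.head (subst (All (λ { (x , y) → DistAtMost n m x y k })) dList≡ bounds)
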